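{- For every integer $k\geq1$ there exists a finite simple graph $G$ of class $2^\pm$ with $\Delta(G)=2k+1$.
   Context: A signed graph is a pair $(G,\sigma)$ with $G$ a finite simple graph and $\sigma\colon E(G)\to\{\pm1\}$ a signature. An incidence is a pair $v\colon e$ with $v$ an endpoint of edge $e$; $I(G)$ is the set of incidences. For a positive integer $n$ let $M_n=\{0,\pm1,\dots,\pm k\}$ if $n=2k+1$ and $M_n=\{\pm1,\dots,\pm k\}$ if $n=2k$. An $n$-edge-coloring of $(G,\sigma)$ is a map $f\colon I(G)\to M_n$ with $f(u\colon uv)=-\sigma(uv)f(v\colon uv)$ for every edge $uv$, and $f(u\colon e_1)\neq f(u\colon e_2)$ whenever $e_1\neq e_2$ are both incident to $u$. The chromatic index $\chi'(G,\sigma)$ is the least positive integer $n$ for which an $n$-edge-coloring exists. A graph $G$ is of class $2^\pm$ if $\chi'(G,\sigma)=\Delta(G)+1$ for every signature $\sigma$ of $G$, where $\Delta(G)$ is the maximum degree. -}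

module Defs where

open import Data.Nat as ℕ using (ℕ; zero; suc; _≤_; _<_; _⊔_)
open import Data.Integer as ℤ using (ℤ; ∣_∣; -_; _*_)
open import Data.Bool using (Bool; true; false; if_then_else_; T)
open import Data.Sign using (Sign)
open import Data.Fin using (Fin)
open import Data.List using (List; map; foldr; allFin)
open import Data.Nat.ListAction using (sum)
open import Data.Product using (Σ; ∃; ∃-syntax; _×_)
open import Data.Sum using (_⊎_)
open import Relation.Binary.PropositionalEquality using (_≡_; _≢_)
open import Relation.Nullary using (¬_)

record Graph : Set where
  field
    n         : ℕ
    adj       : Fin n → Fin n → Bool
    adj-sym   : ∀ u v → adj u v ≡ adj v u
    adj-irref : ∀ u → adj u u ≡ false
open Graph public

deg : (G : Graph) → Fin (n G) → ℕ
deg G u = sum (map (λ v → if adj G u v then 1 else 0) (allFin (n G)))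

Δ : Graph → ℕ
Δ G = foldr _⊔_ 0 (map (deg G) (allFin (n G)))

-- A signature: a sign for each edge; given as a symmetric function on
-- vertex pairs (values on non-edges are irrelevant).
record Signature (G : Graph) : Set where
  field
    σ     : Fin (n G) → Fin (n G) → Sign
    σ-sym : ∀ u v → σ u v ≡ σ v u
open Signature public

signℤ : Sign → ℤ
signℤ Sign.+ = ℤ.+ 1
signℤ Sign.- = ℤ.-[1+ 0 ]

-- The colour set M_m:  {0,±1,…,±k} if m = 2k+1, {±1,…,±k} if m = 2k.
M : ℕ → ℤ → Set
M m c = (∃[ k ] (m ≡ suc (2 ℕ.* k) × ∣ c ∣ ≤ k))
      ⊎ (∃[ k ] (m ≡ 2 ℕ.* k × 1 ≤ ∣ c ∣ × ∣ c ∣ ≤ k))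

-- An incidence colouring: f u v is the colour of the incidence u : uv
-- (only meaningful when uv is an edge).
IsEdgeColoring : (G : Graph) → Signature G → ℕ → (Fin (n G) → Fin (n G) → ℤ) → Set
IsEdgeColoring G s m f =
    (∀ u v → T (adj G u v) → M m (f u v))
  × (∀ u v → T (adj G u v) → f u v ≡ - (signℤ (σ s u v) * f v u))
  × (∀ u v w → T (adj G u v) → T (adj G u w) → v ≢ w → f u v ≢ f u w)

Colorable : (G : Graph) → Signature G → ℕ → Set
Colorable G s m = ∃[ f ] IsEdgeColoring G s m f

ChromaticIndex : (G : Graph) → Signature G → ℕ → Set
ChromaticIndex G s χ =
  1 ≤ χ × Colorable G s χ × (∀ m → 1 ≤ m → m < χ → ¬ Colorable G s m)

Class2± : Graph → Set
Class2± G = ∀ (s : Signature G) → ChromaticIndex G s (suc (Δ G))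

-- G is an apex joined to two hubs, each hub being joined to the ends 0, 1 of the deleted edge
-- in k copies of K_{2k+2} − 01; every vertex but the apex has degree Δ = 2k+1.
-- Upper bound: Walecki's decomposition of K_{2k+2} into k+1 Hamiltonian paths j = 0 … k, with the
-- hub spliced into the path that contained 01.  Orienting a path and propagating the edge signs
-- along it colours it properly with the two colours ±m alone, so each copy uses k+1 magnitudes,
-- permuted so that the hub sees distinct ones; the apex path hub, apex, hub gets ±1.
-- Lower bound: an even palette has fewer than 2k+1 colours, and with the odd palette {0, ±1, …, ±k}
-- every vertex of degree 2k+1 sees the colour 0, whose edges (0 at one end iff at the other) then
-- match all those vertices.  A side has the odd number 1 + k(2k+2) of them, so each hub is matched
-- to the apex, which thereby gets the colour 0 twice.
module Submission where

open import Data.Nat using (ℕ)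
open import Defs

module Counting where

  open import Data.Nat using (ℕ; zero; suc; _+_; _*_; _≤_; _<_; z≤n; _⊔_; _≡ᵇ_)
  open import Data.Nat.Properties
  open import Data.Fin using (Fin; zero; suc; toℕ; fromℕ<; _↑ˡ_; _↑ʳ_; combine)
  open import Data.Fin.Properties using (toℕ-injective; toℕ-fromℕ<) renaming (_≟_ to _≟ᶠ_; suc-injective to Fin-suc-injective)
  open import Data.Fin.Permutation using (permutation)
  open import Data.Bool using (Bool; true; false; if_then_else_; T; _∧_)
  open import Data.Bool.Properties using (T-∧)
  open import Data.List using (map; foldr; allFin; tabulate)
  open import Data.List.Properties using (map-tabulate)
  import Data.Nat.ListAction as List
  open import Data.Product using (∃; _,_)
  open import Data.Empty using (⊥-elim)
  open import Function using (_∘_; Equivalence)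
  open import Relation.Binary.PropositionalEquality
  open import Relation.Nullary using (yes; no)
  open import Relation.Nullary.Decidable using (⌊_⌋)
  open import Algebra.Properties.CommutativeMonoid.Sum +-0-commutativeMonoid public
    using (sum; sum-syntax; ∑-distrib-+; ∑-comm; sum-cong-≗; ∑-permute)
  open import Algebra.Properties.CommutativeMonoid.Sum +-0-commutativeMonoid
    using (sum-replicate-zero)

  𝟙 : Bool → ℕ
  𝟙 true  = 1
  𝟙 false = 0

  𝟙-if : ∀ b → 𝟙 b ≡ (if b then 1 else 0)
  𝟙-if true  = refl
  𝟙-if false = refl

  count : ∀ {n} → (Fin n → Bool) → ℕ
  count {n} P = ∑[ i < n ] 𝟙 (P i)

  _==_ : ∀ {n} → Fin n → Fin n → Bool
  i == j = ⌊ i ≟ᶠ j ⌋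

  ==-refl : ∀ {n} (i : Fin n) → (i == i) ≡ true
  ==-refl i with i ≟ᶠ i
  ... | yes _ = refl
  ... | no i≢i = ⊥-elim (i≢i refl)

  ==-sound : ∀ {n} {i j : Fin n} → T (i == j) → i ≡ j
  ==-sound {i = i} {j} t with i ≟ᶠ j
  ... | yes i≡j = i≡j

  ==-sym : ∀ {n} (i j : Fin n) → (i == j) ≡ (j == i)
  ==-sym i j with i ≟ᶠ j | j ≟ᶠ i
  ... | yes _   | yes _   = refl
  ... | no _    | no _    = refl
  ... | yes i≡j | no j≢i  = ⊥-elim (j≢i (sym i≡j))
  ... | no i≢j  | yes j≡i = ⊥-elim (i≢j (sym j≡i))

  listSum-allFin : ∀ n (f : Fin n → ℕ) → List.sum (map f (allFin n)) ≡ ∑[ i < n ] f i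
  listSum-allFin n f = trans (cong List.sum (map-tabulate (λ i → i) f)) (go n f)
    where
    go : ∀ n (f : Fin n → ℕ) → List.sum (tabulate f) ≡ sum f
    go zero    f = refl
    go (suc n) f = cong (f zero +_) (go n (f ∘ suc))

  max-allFin-attained : ∀ n (f : Fin n → ℕ) {b} → (∀ i → f i ≤ b) → (i : Fin n) → f i ≡ b →
                                foldr _⊔_ 0 (map f (allFin n)) ≡ b
  max-allFin-attained n f {b} f≤b i fi≡b =
    trans (cong (foldr _⊔_ 0) (map-tabulate (λ i → i) f)) (go n f f≤b i fi≡b)
    where
    bounded : ∀ n (f : Fin n → ℕ) → (∀ i → f i ≤ b) → foldr _⊔_ 0 (tabulate f) ≤ b
    bounded zero    f f≤b = z≤n
    bounded (suc n) f f≤b = ⊔-lub (f≤b zero) (bounded n (f ∘ suc) (f≤b ∘ suc))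
    go : ∀ n (f : Fin n → ℕ) → (∀ i → f i ≤ b) → (i : Fin n) → f i ≡ b → foldr _⊔_ 0 (tabulate f) ≡ b
    go (suc n) f f≤b zero    refl = ≤-antisym (bounded (suc n) f f≤b) (m≤m⊔n (f zero) _)
    go (suc n) f f≤b (suc i) fi≡b = ≤-antisym (bounded (suc n) f f≤b)
      (subst (_≤ _) (go n (f ∘ suc) (f≤b ∘ suc) i fi≡b) (m≤n⊔m (f zero) _))

  ∑-mono-≤ : ∀ n {f g : Fin n → ℕ} → (∀ i → f i ≤ g i) → sum f ≤ sum g
  ∑-mono-≤ zero    f≤g = z≤n
  ∑-mono-≤ (suc n) f≤g = +-mono-≤ (f≤g zero) (∑-mono-≤ n (f≤g ∘ suc))

  ∑-const : ∀ n c → ∑[ i < n ] c ≡ n * c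
  ∑-const zero    c = refl
  ∑-const (suc n) c = cong (c +_) (∑-const n c)

  ∑-zero : ∀ n {f : Fin n → ℕ} → (∀ i → f i ≡ 0) → sum f ≡ 0
  ∑-zero n f≡0 = trans (sum-cong-≗ f≡0) (sum-replicate-zero n)

  ∑-↑ : ∀ m n (f : Fin (m + n) → ℕ) → sum f ≡ ∑[ i < m ] f (i ↑ˡ n) + ∑[ i < n ] f (m ↑ʳ i)
  ∑-↑ zero    n f = refl
  ∑-↑ (suc m) n f = trans (cong (f zero +_) (∑-↑ m n (f ∘ suc))) (sym (+-assoc (f zero) _ _))

  ∑-combine : ∀ m n (f : Fin (m * n) → ℕ) → sum f ≡ ∑[ i < m ] ∑[ j < n ] f (combine i j)
  ∑-combine zero    n f = refl
  ∑-combine (suc m) n f =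
    trans (∑-↑ n (m * n) f) (cong (∑[ j < n ] f (j ↑ˡ (m * n)) +_) (∑-combine m n (f ∘ (n ↑ʳ_))))

  ∑-select : ∀ n (a : Fin n) (h : Fin n → ℕ) → ∑[ i < n ] (if i == a then h i else 0) ≡ h a
  ∑-select (suc n) zero    h = trans (cong (h zero +_) (∑-zero n (λ _ → refl))) (+-identityʳ _)
  ∑-select (suc n) (suc a) h = trans (sum-cong-≗ shift) (∑-select n a (h ∘ suc))
    where
    shift : ∀ i → (if suc i == suc a then h (suc i) else 0) ≡ (if i == a then h (suc i) else 0)
    shift i with i ≟ᶠ a
    ... | yes _ = refl
    ... | no _  = refl

  count-== : ∀ n (a : Fin n) → count (_== a) ≡ 1
  count-== n a = trans (sum-cong-≗ (λ i → 𝟙-if (i == a))) (∑-select n a (λ _ → 1))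

  ∑-involution : ∀ n (p : Fin n → Fin n) → (∀ i → p (p i) ≡ i) → (g : Fin n → ℕ) → ∑[ i < n ] g (p i) ≡ sum g
  ∑-involution n p p∘p g = sym (∑-permute g (permutation p p p∘p p∘p))

  count≤1 : ∀ n (P : Fin n → Bool) → (∀ i j → T (P i) → T (P j) → i ≡ j) → count P ≤ 1
  count≤1 zero    P unique = z≤n
  count≤1 (suc n) P unique with P zero in P0
  ... | false = count≤1 n (P ∘ suc) (λ i j Pi Pj → Fin-suc-injective (unique (suc i) (suc j) Pi Pj))
  ... | true  = ≤-reflexive (cong suc (∑-zero n rest))
    where
    rest : ∀ i → 𝟙 (P (suc i)) ≡ 0
    rest i with P (suc i) in Pi
    ... | false = refl
    ... | true with unique zero (suc i) (subst T (sym P0) _) (subst T (sym Pi) _)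
    ... | ()

  count≤-injective-label : ∀ n r (P : Fin n → Bool) (h : Fin n → ℕ) → (∀ v → T (P v) → h v < r) →
                           (∀ v w → T (P v) → T (P w) → h v ≡ h w → v ≡ w) → count P ≤ r
  count≤-injective-label n r P h h<r h-inj = begin
    count P                                   ≤⟨ ∑-mono-≤ n ≤fibres ⟩
    ∑[ v < n ] ∑[ c < r ] 𝟙 (labelled v c)    ≡⟨ ∑-comm (λ v c → 𝟙 (labelled v c)) ⟩
    ∑[ c < r ] count (λ v → labelled v c)     ≤⟨ ∑-mono-≤ r (λ c → count≤1 n _ (fibre-unique c)) ⟩
    ∑[ c < r ] 1                              ≡⟨ trans (∑-const r 1) (*-identityʳ r) ⟩
    r                                         ∎
    where
    open ≤-Reasoning
    labelled : Fin n → Fin r → Bool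
    labelled v c = P v ∧ (toℕ c ≡ᵇ h v)
    fibre-unique : ∀ c v w → T (labelled v c) → T (labelled w c) → v ≡ w
    fibre-unique c v w lv lw with Equivalence.to T-∧ lv | Equivalence.to T-∧ lw
    ... | Pv , cv | Pw , cw = h-inj v w Pv Pw (trans (sym (≡ᵇ⇒≡ (toℕ c) (h v) cv)) (≡ᵇ⇒≡ (toℕ c) (h w) cw))
    ≤fibres : ∀ v → 𝟙 (P v) ≤ ∑[ c < r ] 𝟙 (labelled v c)
    ≤fibres v with P v in Pv
    ... | false = z≤n
    ... | true  = ≤-reflexive (sym (trans (sum-cong-≗ at-label) (count-== r (fromℕ< hv<r))))
      where
      hv<r = h<r v (subst T (sym Pv) _)
      at-label : ∀ c → 𝟙 (toℕ c ≡ᵇ h v) ≡ 𝟙 (c == fromℕ< hv<r)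
      at-label c with toℕ c ≡ᵇ h v in c≡ | c ≟ᶠ fromℕ< hv<r
      ... | true  | yes _ = refl
      ... | false | no _  = refl
      ... | true  | no c≢ = ⊥-elim (c≢ (toℕ-injective (trans (≡ᵇ⇒≡ _ _ (subst T (sym c≡) _)) (sym (toℕ-fromℕ< hv<r)))))
      ... | false | yes refl = ⊥-elim (subst T c≡ (≡⇒≡ᵇ _ _ (toℕ-fromℕ< hv<r)))

  -- Each orbit {i, p i} contributes exactly one index with toℕ i < toℕ (p i).
  involution-fixedPointFree⇒even : ∀ n (p : Fin n → Fin n) → (∀ i → p (p i) ≡ i) → (∀ i → p i ≢ i) →
                                   ∃ λ q → n ≡ q + q
  involution-fixedPointFree⇒even n p p∘p p-fpf = below , sym halves
    where
    below-p : Fin n → ℕ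
    below-p i = 𝟙 ⌊ toℕ i <? toℕ (p i) ⌋
    above-p : Fin n → ℕ
    above-p i = 𝟙 ⌊ toℕ (p i) <? toℕ i ⌋
    below = sum below-p
    below-p∘p : ∀ i → below-p (p i) ≡ above-p i
    below-p∘p i = cong (λ z → 𝟙 ⌊ toℕ (p i) <? toℕ z ⌋) (p∘p i)
    one-of : ∀ i → below-p i + above-p i ≡ 1
    one-of i with toℕ i <? toℕ (p i) | toℕ (p i) <? toℕ i
    ... | yes i<pi | yes pi<i = ⊥-elim (<-asym i<pi pi<i)
    ... | yes _    | no _     = refl
    ... | no _     | yes _    = refl
    ... | no i≮pi  | no pi≮i  = ⊥-elim (p-fpf i (toℕ-injective (≤-antisym (≮⇒≥ i≮pi) (≮⇒≥ pi≮i))))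
    halves : below + below ≡ n
    halves = begin
      below + below                          ≡⟨ cong (below +_) (sym (∑-involution n p p∘p below-p)) ⟩
      below + ∑[ i < n ] below-p (p i)       ≡⟨ cong (below +_) (sum-cong-≗ below-p∘p) ⟩
      below + sum above-p                    ≡⟨ sym (∑-distrib-+ below-p above-p) ⟩
      ∑[ i < n ] (below-p i + above-p i)     ≡⟨ sum-cong-≗ one-of ⟩
      ∑[ i < n ] 1                           ≡⟨ trans (∑-const n 1) (*-identityʳ n) ⟩
      n                                      ∎
      where open ≡-Reasoning

module Parity where

  open import Data.Nat using (zero; suc; _+_; _*_; _≤_; z≤n; s≤s; ⌊_/2⌋)
  open import Data.Product using (∃; _×_; _,_)
  open import Relation.Binary.PropositionalEquality using (_≡_; refl; cong; trans)
  open import Data.Nat.Tactic.RingSolver using (solve-∀)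

  parity : ∀ n → ∃ λ e → e ≤ 1 × n ≡ e + 2 * ⌊ n /2⌋
  parity zero          = 0 , z≤n , refl
  parity (suc zero)    = 1 , s≤s z≤n , refl
  parity (suc (suc n)) with parity n
  ... | e , e≤1 , n≡ = e , e≤1 , trans (cong (λ m → suc (suc m)) n≡) (shift e ⌊ n /2⌋)
    where
    shift : ∀ e h → suc (suc (e + 2 * h)) ≡ e + 2 * suc h
    shift = solve-∀

module SignedColour where

  open import Data.Nat using (ℕ; suc; pred)
  open import Data.Nat.Properties using (+-identityʳ)
  open import Data.Integer using (ℤ; _◃_; -_; _*_; +_; -[1+_]; ∣_∣)
  open import Data.Integer.Properties using (neg-involutive; *-identityˡ; -1*i≡-i; abs-◃; abs-cong; sign-cong′)
  open import Data.Sign as Sign using (Sign; opposite)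
  open import Data.Sum using (inj₁; inj₂)
  open import Data.Product using (_,_)
  open import Relation.Binary.PropositionalEquality

  -- The colour ±(m+1); the magnitudes m ≤ k are exactly the colours of M (2k+2).
  colour : Sign → ℕ → ℤ
  colour s m = s ◃ suc m

  ∣colour∣ : ∀ s m → ∣ colour s m ∣ ≡ suc m
  ∣colour∣ s m = abs-◃ s (suc m)

  colour-injectiveˡ : ∀ {s t m n} → colour s m ≡ colour t n → s ≡ t
  colour-injectiveˡ e with sign-cong′ e
  ... | inj₁ s≡t = s≡t
  ... | inj₂ (() , _)

  colour-injectiveʳ : ∀ {s t m n} → colour s m ≡ colour t n → m ≡ n
  colour-injectiveʳ e = cong pred (abs-cong e)

  neg-colour : ∀ s m → - colour s m ≡ colour (opposite s) m
  neg-colour Sign.+ m = refl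
  neg-colour Sign.- m = refl

  signℤ*colour : ∀ σ s m → signℤ σ * colour s m ≡ colour (σ Sign.* s) m
  signℤ*colour Sign.+ Sign.+ m = cong (λ z → + suc z) (+-identityʳ m)
  signℤ*colour Sign.+ Sign.- m = cong (λ z → -[1+ z ]) (+-identityʳ m)
  signℤ*colour Sign.- Sign.+ m = cong (λ z → -[1+ z ]) (+-identityʳ m)
  signℤ*colour Sign.- Sign.- m = cong (λ z → + suc z) (+-identityʳ m)

  colour-across : ∀ σ t m → colour t m ≡ - (signℤ σ * colour (opposite (σ Sign.* t)) m)
  colour-across σ t m =
    sym (trans (cong -_ (signℤ*colour σ _ m)) (trans (neg-colour _ m) (cong (λ s → colour s m) (undo σ t))))
    where
    undo : ∀ σ t → opposite (σ Sign.* opposite (σ Sign.* t)) ≡ t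
    undo Sign.+ Sign.+ = refl
    undo Sign.+ Sign.- = refl
    undo Sign.- Sign.+ = refl
    undo Sign.- Sign.- = refl

  across-sym : ∀ σ a b → a ≡ - (signℤ σ * b) → b ≡ - (signℤ σ * a)
  across-sym Sign.+ a b refl = sym (trans (cong -_ (*-identityˡ _)) (trans (neg-involutive _) (*-identityˡ b)))
  across-sym Sign.- a b refl =
    sym (trans (cong -_ (-1*i≡-i _)) (trans (neg-involutive _) (trans (cong -_ (-1*i≡-i b)) (neg-involutive b))))

module Walecki (k : ℕ) where

  open import Data.Nat using (ℕ; zero; suc; _+_; _*_; _∸_; _≤_; _<_; z≤n; s≤s; ⌊_/2⌋; _%_)
  open import Data.Nat.Properties
  open import Data.Nat.DivMod using (_/_; m≡m%n+[m/n]*n; m%n<n; [m+kn]%n≡m%n; m<n⇒m%n≡m)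
  open import Data.Product using (∃; ∃₂; _×_; _,_)
  open import Data.Sum using (_⊎_; inj₁; inj₂; swap)
  open import Relation.Binary using (tri<; tri≈; tri>)
  open import Relation.Binary.PropositionalEquality
  open import Relation.Nullary using (yes; no)
  open import Data.Empty using (⊥-elim)
  open import Data.Bool using (Bool; true; false; T)
  open import Relation.Nullary.Decidable using (⌊_⌋)
  open import Data.Nat.Tactic.RingSolver using (solve-∀)
  open Parity

  N : ℕ
  N = suc (suc (k + k))

  -- Path j of the Walecki decomposition of K_N visits j, j+1, j−1, j+2, j−2, …, j+k+1 (mod N);
  -- back i is its vertex j−i and fore i its vertex j+i+1.
  data Slot : Set where
    back fore : ℕ → Slot

  Valid : Slot → Set
  Valid (back i) = i ≤ k
  Valid (fore i) = i ≤ k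

  offset : Slot → ℕ
  offset (back i) = N ∸ i
  offset (fore i) = suc i

  slotAtOffset : ℕ → Slot
  slotAtOffset zero = back 0
  slotAtOffset (suc b) with b ≤? k
  ... | yes _ = fore b
  ... | no _  = back (N ∸ suc b)

  slot : ℕ → ℕ → Slot
  slot j x with x <? j
  ... | yes _ = back (j ∸ x)
  ... | no _  = slotAtOffset (x ∸ j)

  vertexAt : ℕ → Slot → ℕ
  vertexAt j r = (j + offset r) % N

  k<N : k < N
  k<N = s≤s (≤-trans (m≤m+n k k) (n≤1+n _))

  N≡2*[1+k] : N ≡ 2 * suc k
  N≡2*[1+k] = by-ring k
    where
    by-ring : ∀ k → suc (suc (k + k)) ≡ 2 * suc k
    by-ring = solve-∀

  slot-offset : ∀ {j x} → j ≤ k → x < N → ∃ λ q → j + offset (slot j x) ≡ x + q * N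
  slot-offset {j} {x} j≤k x<N with x <? j
  ... | yes x<j = 1 , (begin
        j + (N ∸ (j ∸ x))              ≡⟨ cong (_+ (N ∸ (j ∸ x))) (sym (m+[n∸m]≡n (<⇒≤ x<j))) ⟩
        x + (j ∸ x) + (N ∸ (j ∸ x))    ≡⟨ +-assoc x _ _ ⟩
        x + ((j ∸ x) + (N ∸ (j ∸ x)))  ≡⟨ cong (x +_) (m+[n∸m]≡n (≤-trans (m∸n≤m j x) (≤-trans j≤k (<⇒≤ k<N)))) ⟩
        x + N                          ≡⟨ cong (x +_) (sym (+-identityʳ N)) ⟩
        x + 1 * N                      ∎)
    where open ≡-Reasoning
  ... | no x≮j = at-offset (x ∸ j) (m+[n∸m]≡n (≮⇒≥ x≮j)) (m∸n≤m x j)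
    where
    at-offset : ∀ a → j + a ≡ x → a ≤ x → ∃ λ q → j + offset (slotAtOffset a) ≡ x + q * N
    at-offset zero    j≡x _ = 1 , trans (cong (_+ N) (trans (sym (+-identityʳ j)) j≡x)) (cong (x +_) (sym (+-identityʳ N)))
    at-offset (suc b) j+a≡x a≤x with b ≤? k
    ... | yes _ = 0 , trans j+a≡x (sym (+-identityʳ x))
    ... | no _  = 0 , trans (cong (j +_) (m∸[m∸n]≡n (<⇒≤ (≤-<-trans a≤x x<N)))) (trans j+a≡x (sym (+-identityʳ x)))

  slot-valid : ∀ {j x} → j ≤ k → Valid (slot j x)
  slot-valid {j} {x} j≤k with x <? j
  ... | yes _ = ≤-trans (m∸n≤m j x) j≤k
  ... | no _  = at-offset (x ∸ j)
    where
    N∸[2+k]≡k : N ∸ suc (suc k) ≡ k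
    N∸[2+k]≡k = trans (cong (λ z → suc (suc z) ∸ suc (suc k)) (+-comm k k)) (m+n∸n≡m k k)
    at-offset : ∀ a → Valid (slotAtOffset a)
    at-offset zero = z≤n
    at-offset (suc b) with b ≤? k
    ... | yes b≤k = b≤k
    ... | no b≰k  = ≤-trans (∸-monoʳ-≤ N (s≤s (≰⇒> b≰k))) (≤-reflexive N∸[2+k]≡k)

  vertexAt-slot : ∀ {j x} → j ≤ k → x < N → vertexAt j (slot j x) ≡ x
  vertexAt-slot {j} {x} j≤k x<N with slot-offset {j} {x} j≤k x<N
  ... | q , e = trans (cong (_% N) e) (trans ([m+kn]%n≡m%n x q N) (m<n⇒m%n≡m x<N))

  slot-injective : ∀ {j x y} → j ≤ k → x < N → y < N → slot j x ≡ slot j y → x ≡ y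
  slot-injective {j} j≤k x<N y<N e =
    trans (sym (vertexAt-slot j≤k x<N)) (trans (cong (vertexAt j) e) (vertexAt-slot j≤k y<N))

  -- The index of the path through the edge xy.
  pathIndex : ℕ → ℕ → ℕ
  pathIndex x y = ⌊ (x + y) % N /2⌋

  pathIndex-sym : ∀ x y → pathIndex x y ≡ pathIndex y x
  pathIndex-sym x y = cong (λ s → ⌊ s % N /2⌋) (+-comm x y)

  pathIndex≤k : ∀ x y → pathIndex x y ≤ k
  pathIndex≤k x y with parity ((x + y) % N)
  ... | e , _ , s≡ = ≤-pred (*-cancelˡ-< 2 _ (suc k) (begin-strict
      2 * pathIndex x y      ≤⟨ m≤n+m _ e ⟩
      e + 2 * pathIndex x y  ≡⟨ sym s≡ ⟩
      (x + y) % N            <⟨ m%n<n (x + y) N ⟩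
      N                      ≡⟨ N≡2*[1+k] ⟩
      2 * suc k              ∎))
    where open ≤-Reasoning

  -- As 2 · pathIndex x y ≡ x + y − e (mod N) with e ≤ 1, the offsets of x and y on that path sum to e.
  offset-sum : ∀ {x y} → x < N → y < N →
               ∃₂ λ e t → e ≤ 1 × offset (slot (pathIndex x y) x) + offset (slot (pathIndex x y) y) ≡ e + t * N
  offset-sum {x} {y} x<N y<N
    with slot-offset {pathIndex x y} {x} (pathIndex≤k x y) x<N | slot-offset {pathIndex x y} {y} (pathIndex≤k x y) y<N
       | parity ((x + y) % N)
  ... | qx , ex | qy , ey | e , e≤1 , s≡ = e , (x + y) / N + qx + qy , e≤1 , +-cancelʳ-≡ (2 * j) _ _ (begin
      Ox + Oy + 2 * j               ≡⟨ regroup Ox Oy j ⟩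
      (j + Ox) + (j + Oy)           ≡⟨ cong₂ _+_ ex ey ⟩
      (x + qx * N) + (y + qy * N)   ≡⟨ collect x y qx qy N ⟩
      (x + y) + (qx + qy) * N       ≡⟨ cong (_+ (qx + qy) * N) (m≡m%n+[m/n]*n (x + y) N) ⟩
      (x + y) % N + q * N + (qx + qy) * N  ≡⟨ cong (λ s → s + q * N + (qx + qy) * N) s≡ ⟩
      e + 2 * j + q * N + (qx + qy) * N    ≡⟨ reorder e j q qx qy N ⟩
      e + (q + qx + qy) * N + 2 * j ∎)
    where
    open ≡-Reasoning
    j = pathIndex x y
    q = (x + y) / N
    Ox = offset (slot j x)
    Oy = offset (slot j y)
    regroup : ∀ a b j → a + b + 2 * j ≡ (j + a) + (j + b)
    regroup = solve-∀
    collect : ∀ x y a b N → (x + a * N) + (y + b * N) ≡ (x + y) + (a + b) * N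
    collect = solve-∀
    reorder : ∀ e j q a b N → e + 2 * j + q * N + (a + b) * N ≡ e + (q + a + b) * N + 2 * j
    reorder = solve-∀

  data Step : Slot → Slot → Set where
    back→fore : ∀ i → Step (back i) (fore i)
    fore→back : ∀ i → Step (fore i) (back (suc i))

  Consecutive : Slot → Slot → Set
  Consecutive r r′ = Step r r′ ⊎ Step r′ r

  quotient-in-window : ∀ {e t} a → e ≤ 1 → 2 + a * N ≤ e + t * N → e + t * N < suc (suc a) * N → t ≡ suc a
  quotient-in-window {e} {t} a e≤1 lo hi with <-cmp t (suc a)
  ... | tri< t<1+a _ _ = ⊥-elim (1+n≰n (≤-trans lo (+-mono-≤ e≤1 (*-monoˡ-≤ N (≤-pred t<1+a)))))
  ... | tri≈ _ t≡1+a _ = t≡1+a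
  ... | tri> _ _ 1+a<t = ⊥-elim (<⇒≱ hi (≤-trans (*-monoˡ-≤ N 1+a<t) (m≤n+m (t * N) e)))

  N∸-lower : ∀ {a} → a ≤ k → suc (suc k) ≤ N ∸ a
  N∸-lower {a} a≤k = ≤-trans (≤-reflexive (sym N∸k≡2+k)) (∸-monoʳ-≤ N a≤k)
    where
    N∸k≡2+k : N ∸ k ≡ suc (suc k)
    N∸k≡2+k = trans (cong (λ z → suc (suc z) ∸ k) (+-comm k k))
                    (trans (+-∸-assoc 2 {k + k} {k} (m≤n+m k k)) (cong (2 +_) (m+n∸n≡m k k)))

  maximal-summand : ∀ {x y n} → y ≤ n → x + y ≡ n + n → n ≤ x
  maximal-summand {x} {y} {n} y≤n x+y≡ = +-cancelʳ-≤ n n x (subst (_≤ x + n) x+y≡ (+-monoʳ-≤ x y≤n))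

  N∸a≡N⇒a≡0 : ∀ {a} → a ≤ k → N ≤ N ∸ a → a ≡ 0
  N∸a≡N⇒a≡0 {a} a≤k N≤N∸a = n≤0⇒n≡0 (+-cancelˡ-≤ N a 0 (begin
    N + a        ≤⟨ +-monoˡ-≤ a N≤N∸a ⟩
    N ∸ a + a    ≡⟨ m∸n+n≡m (≤-trans a≤k (<⇒≤ k<N)) ⟩
    N            ≡⟨ sym (+-identityʳ N) ⟩
    N + 0        ∎))
    where open ≤-Reasoning

  back-back-offsets : ∀ {a b e t} → a ≤ k → b ≤ k → e ≤ 1 → (N ∸ a) + (N ∸ b) ≡ e + t * N → a ≡ b
  back-back-offsets {a} {b} {e} {t} a≤k b≤k e≤1 s≡ =
    trans (N∸a≡N⇒a≡0 a≤k (maximal-summand (m∸n≤m N b) s≡N+N))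
          (sym (N∸a≡N⇒a≡0 b≤k (maximal-summand (m∸n≤m N a) (trans (+-comm (N ∸ b) (N ∸ a)) s≡N+N))))
    where
    s≤N+N : (N ∸ a) + (N ∸ b) ≤ N + N
    s≤N+N = +-mono-≤ (m∸n≤m N a) (m∸n≤m N b)
    lower : ∀ k → 2 + 1 * suc (suc (k + k)) ≡ suc (suc k) + suc (suc k)
    lower = solve-∀
    upper : ∀ k → 3 * suc (suc (k + k)) ≡ suc (suc (k + k)) + suc (suc (k + k)) + suc (suc (k + k))
    upper = solve-∀
    t≡2 : t ≡ 2
    t≡2 = quotient-in-window 1 e≤1
      (subst (2 + 1 * N ≤_) s≡ (≤-trans (≤-reflexive (lower k)) (+-mono-≤ (N∸-lower a≤k) (N∸-lower b≤k))))
      (subst (_< 3 * N) s≡ (≤-<-trans s≤N+N (subst (N + N <_) (sym (upper k)) (m<m+n (N + N) (s≤s z≤n)))))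
    s≡N+N : (N ∸ a) + (N ∸ b) ≡ N + N
    s≡N+N = ≤-antisym s≤N+N (subst (N + N ≤_) (sym s≡)
      (subst (λ t → N + N ≤ e + t * N) (sym t≡2) (subst (_≤ e + 2 * N) (cong (N +_) (+-identityʳ N)) (m≤n+m (2 * N) e))))

  fore-fore-offsets : ∀ {a b e t} → a ≤ k → b ≤ k → e ≤ 1 → suc a + suc b ≡ e + t * N → a ≡ b
  fore-fore-offsets {a} {b} {e} {t} a≤k b≤k e≤1 s≡ =
    trans (≤-antisym a≤k (maximal-summand b≤k a+b≡k+k)) (sym (≤-antisym b≤k (maximal-summand a≤k (trans (+-comm b a) a+b≡k+k))))
    where
    s≤N : suc a + suc b ≤ N
    s≤N = ≤-trans (+-mono-≤ (s≤s a≤k) (s≤s b≤k)) (≤-reflexive (cong suc (+-suc k k)))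
    t≡1 : t ≡ 1
    t≡1 = quotient-in-window 0 e≤1
      (subst (2 ≤_) s≡ (s≤s (≤-trans (s≤s z≤n) (m≤n+m (suc b) a))))
      (subst (_< 2 * N) s≡ (≤-<-trans s≤N (subst (N <_) (cong (N +_) (sym (+-identityʳ N))) (m<m+n N (s≤s z≤n)))))
    s≡N : suc a + suc b ≡ N
    s≡N = ≤-antisym s≤N (subst (N ≤_) (sym s≡)
      (subst (λ t → N ≤ e + t * N) (sym t≡1) (subst (_≤ e + 1 * N) (+-identityʳ N) (m≤n+m (1 * N) e))))
    a+b≡k+k : a + b ≡ k + k
    a+b≡k+k = suc-injective (suc-injective (trans (cong suc (sym (+-suc a b))) s≡N))

  back-fore-offsets : ∀ {a b e t} → a ≤ k → b ≤ k → e ≤ 1 → (N ∸ a) + suc b ≡ e + t * N → Consecutive (back a) (fore b)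
  back-fore-offsets {a} {b} {e} {t} a≤k b≤k e≤1 s≡ = consecutive e e≤1 1+b≡e+a
    where
    open ≤-Reasoning
    t≡1 : t ≡ 1
    t≡1 = quotient-in-window 0 e≤1
      (subst (2 ≤_) s≡ (≤-trans (s≤s (s≤s z≤n)) (≤-trans (N∸-lower a≤k) (m≤m+n (N ∸ a) (suc b)))))
      (subst (_< 2 * N) s≡ (begin-strict
        (N ∸ a) + suc b   ≤⟨ +-mono-≤ (m∸n≤m N a) (s≤s b≤k) ⟩
        N + suc k         <⟨ +-monoʳ-< N (s≤s (s≤s (m≤m+n k k))) ⟩
        N + N             ≡⟨ cong (N +_) (sym (+-identityʳ N)) ⟩
        2 * N             ∎))
    1+b≡e+a : suc b ≡ e + a
    1+b≡e+a = +-cancelˡ-≡ (N ∸ a) _ _ (begin-equality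
      (N ∸ a) + suc b       ≡⟨ s≡ ⟩
      e + t * N             ≡⟨ cong (λ t → e + t * N) t≡1 ⟩
      e + (N + 0)           ≡⟨ cong (e +_) (trans (+-identityʳ N) (sym (m∸n+n≡m (≤-trans a≤k (<⇒≤ k<N))))) ⟩
      e + ((N ∸ a) + a)     ≡⟨ interchange e (N ∸ a) a ⟩
      (N ∸ a) + (e + a)     ∎)
      where
      interchange : ∀ e x a → e + (x + a) ≡ x + (e + a)
      interchange = solve-∀
    consecutive : ∀ e → e ≤ 1 → suc b ≡ e + a → Consecutive (back a) (fore b)
    consecutive zero       _ refl = inj₂ (fore→back b)
    consecutive (suc zero) _ refl = inj₁ (back→fore b)
    consecutive (suc (suc _)) (s≤s ()) _

  consecutive-of-offsets : ∀ {r r′ e t} → Valid r → Valid r′ → r ≢ r′ → e ≤ 1 →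
                           offset r + offset r′ ≡ e + t * N → Consecutive r r′
  consecutive-of-offsets {back a} {back b} {e} {t} a≤k b≤k r≢r′ e≤1 s≡ =
    ⊥-elim (r≢r′ (cong back (back-back-offsets {t = t} a≤k b≤k e≤1 s≡)))
  consecutive-of-offsets {fore a} {fore b} {e} {t} a≤k b≤k r≢r′ e≤1 s≡ =
    ⊥-elim (r≢r′ (cong fore (fore-fore-offsets {t = t} a≤k b≤k e≤1 s≡)))
  consecutive-of-offsets {back a} {fore b} {e} {t} a≤k b≤k _ e≤1 s≡ = back-fore-offsets {t = t} a≤k b≤k e≤1 s≡
  consecutive-of-offsets {fore a} {back b} {e} {t} a≤k b≤k _ e≤1 s≡ =
    swap (back-fore-offsets {t = t} b≤k a≤k e≤1 (trans (+-comm (N ∸ b) (suc a)) s≡))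

  pathIndex-consecutive : ∀ {x y} → x < N → y < N → x ≢ y → Consecutive (slot (pathIndex x y) x) (slot (pathIndex x y) y)
  pathIndex-consecutive {x} {y} x<N y<N x≢y = from-offset-sum (offset-sum x<N y<N)
    where
    j = pathIndex x y
    from-offset-sum : (∃₂ λ e t → e ≤ 1 × offset (slot j x) + offset (slot j y) ≡ e + t * N) → Consecutive (slot j x) (slot j y)
    from-offset-sum (e , t , e≤1 , s≡) =
      consecutive-of-offsets {slot j x} {slot j y} {e} {t} (slot-valid {x = x} (pathIndex≤k x y)) (slot-valid {x = y} (pathIndex≤k x y))
        (λ same → x≢y (slot-injective (pathIndex≤k x y) x<N y<N same)) e≤1 s≡

  rank : Slot → ℕ
  rank (back a) = a + a
  rank (fore a) = suc (a + a)

  precedes : Slot → Slot → Bool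
  precedes r r′ = ⌊ rank r <? rank r′ ⌋

  Step-rank : ∀ {r r′} → Step r r′ → rank r < rank r′
  Step-rank (back→fore a) = ≤-refl
  Step-rank (fore→back a) = s≤s (≤-reflexive (sym (+-suc a a)))

  Step⇒precedes : ∀ {r r′} → Step r r′ → precedes r r′ ≡ true
  Step⇒precedes {r} {r′} st with rank r <? rank r′
  ... | yes _ = refl
  ... | no r≮r′ = ⊥-elim (r≮r′ (Step-rank st))

  Step⇒¬precedes : ∀ {r r′} → Step r r′ → precedes r′ r ≡ false
  Step⇒¬precedes {r} {r′} st with rank r′ <? rank r
  ... | yes r′<r = ⊥-elim (<-asym r′<r (Step-rank st))
  ... | no _ = refl

  consecutive-unique : ∀ {r r₁ r₂} → Consecutive r r₁ → Consecutive r r₂ → precedes r r₁ ≡ precedes r r₂ → r₁ ≡ r₂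
  consecutive-unique (inj₁ (back→fore a)) (inj₁ (back→fore .a)) _ = refl
  consecutive-unique (inj₁ (fore→back a)) (inj₁ (fore→back .a)) _ = refl
  consecutive-unique (inj₂ (back→fore a)) (inj₂ (back→fore .a)) _ = refl
  consecutive-unique (inj₂ (fore→back a)) (inj₂ (fore→back .a)) _ = refl
  consecutive-unique (inj₁ st₁) (inj₂ st₂) same =
    ⊥-elim (subst T (trans (sym (Step⇒precedes st₁)) (trans same (Step⇒¬precedes st₂))) _)
  consecutive-unique (inj₂ st₁) (inj₁ st₂) same =
    ⊥-elim (subst T (trans (sym (Step⇒precedes st₂)) (trans (sym same) (Step⇒¬precedes st₁))) _)

-- K_N without the edge 01; in G a hub vertex is joined to 0 and 1 instead.
module Gadget (k : ℕ) where

  open import Data.Nat using (zero; suc; _+_; _≤_; _<_; z≤n; s≤s; _≟_)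
  open import Data.Nat.Properties using (≤-trans; ≤-reflexive; <-irrefl; 1+n≢0; suc-injective; +-assoc; *-identityʳ)
  open import Data.Nat.DivMod using (_mod_; m%n<n; n%n≡0; m<n⇒m%n≡m)
  open import Data.Fin using (Fin; zero; suc; toℕ)
  open import Data.Fin.Properties using (toℕ<n; toℕ-fromℕ<; toℕ-injective)
  open import Data.Bool using (Bool; true; false; if_then_else_; T; _∧_; not)
  open import Data.Integer using (ℤ; -_; _*_)
  open import Data.Sign as Sign using (Sign; opposite)
  open import Data.Sign.Properties using (s≢opposite[s]) renaming (*-identityʳ to Sign-*-identityʳ)
  open import Data.Product using (∃₂; _×_; _,_; proj₁; proj₂)
  open import Data.Sum using (inj₁; inj₂)
  open import Relation.Binary.PropositionalEquality
  open import Relation.Nullary using (¬_; yes; no)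
  open import Data.Empty using (⊥-elim)
  open Counting
  open SignedColour
  open Walecki k public

  isHubPair : Fin N → Fin N → Bool
  isHubPair zero       (suc zero) = true
  isHubPair (suc zero) zero       = true
  isHubPair _          _          = false

  gadgetAdj : Fin N → Fin N → Bool
  gadgetAdj x y = not (x == y) ∧ not (isHubPair x y)

  gadgetAdj-sym : ∀ x y → gadgetAdj x y ≡ gadgetAdj y x
  gadgetAdj-sym x y = cong₂ (λ a b → not a ∧ not b) (==-sym x y) (isHubPair-sym x y)
    where
    isHubPair-sym : ∀ x y → isHubPair x y ≡ isHubPair y x
    isHubPair-sym zero             zero             = refl
    isHubPair-sym zero             (suc zero)       = refl
    isHubPair-sym zero             (suc (suc y))    = refl
    isHubPair-sym (suc zero)       zero             = refl
    isHubPair-sym (suc zero)       (suc zero)       = refl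
    isHubPair-sym (suc zero)       (suc (suc y))    = refl
    isHubPair-sym (suc (suc x))    zero             = refl
    isHubPair-sym (suc (suc x))    (suc zero)       = refl
    isHubPair-sym (suc (suc x))    (suc (suc y))    = refl

  gadgetAdj-irrefl : ∀ x → gadgetAdj x x ≡ false
  gadgetAdj-irrefl x rewrite ==-refl x = refl

  gadgetAdj⇒≢ : ∀ {x y} → T (gadgetAdj x y) → x ≢ y
  gadgetAdj⇒≢ {x} adj refl rewrite gadgetAdj-irrefl x = adj

  ¬gadgetAdj-01 : ¬ T (gadgetAdj zero (suc zero))
  ¬gadgetAdj-01 adj with zero == suc {N} zero
  ... | true  = adj
  ... | false = adj

  ¬gadgetAdj-10 : ¬ T (gadgetAdj (suc zero) zero)
  ¬gadgetAdj-10 adj with suc {N} zero == zero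
  ... | true  = adj
  ... | false = adj

  vertex : ℕ → Slot → Fin N
  vertex j r = (j + offset r) mod N

  vertex-slot : ∀ {j} (x : Fin N) → j ≤ k → vertex j (slot j (toℕ x)) ≡ x
  vertex-slot x j≤k = toℕ-injective (trans (toℕ-fromℕ< _) (vertexAt-slot j≤k (toℕ<n x)))

  vertex-back0 : vertex 0 (back 0) ≡ zero
  vertex-back0 = toℕ-injective (trans (toℕ-fromℕ< (m%n<n N N)) (n%n≡0 N))

  vertex-fore0 : vertex 0 (fore 0) ≡ suc zero
  vertex-fore0 = toℕ-injective (trans (toℕ-fromℕ< (m%n<n 1 N)) (m<n⇒m%n≡m {n = N} {m = 1} (s≤s (s≤s z≤n))))

  ≢⇒toℕ≢ : ∀ {x y : Fin N} → x ≢ y → toℕ x ≢ toℕ y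
  ≢⇒toℕ≢ x≢y e = x≢y (toℕ-injective e)

  consecutive : ∀ {x y : Fin N} → T (gadgetAdj x y) →
                Consecutive (slot (pathIndex (toℕ x) (toℕ y)) (toℕ x)) (slot (pathIndex (toℕ x) (toℕ y)) (toℕ y))
  consecutive {x} {y} adj = pathIndex-consecutive (toℕ<n x) (toℕ<n y) (≢⇒toℕ≢ (gadgetAdj⇒≢ adj))

  -- The colouring of the gadget for the signature σ, in which the path through the hub
  -- (0, hub, 1 in place of the missing edge 01) gets magnitude i.
  module Colouring (i : ℕ) (1≤i : 1 ≤ i) (i≤k : i ≤ k)
                   (σ : Fin N → Fin N → Sign) (σ-sym : ∀ x y → σ x y ≡ σ y x) (σ₀ σ₁ : Sign) where

    magnitude : ℕ → ℕ
    magnitude zero = i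
    magnitude (suc j) with suc j ≟ i
    ... | yes _ = 0
    ... | no _  = suc j

    magnitude≤k : ∀ j → j ≤ k → magnitude j ≤ k
    magnitude≤k zero    _ = i≤k
    magnitude≤k (suc j) j≤k with suc j ≟ i
    ... | yes _ = z≤n
    ... | no _  = j≤k

    magnitude-injective : ∀ j j′ → magnitude j ≡ magnitude j′ → j ≡ j′
    magnitude-injective zero zero _ = refl
    magnitude-injective zero (suc j′) e with suc j′ ≟ i
    ... | yes _   = ⊥-elim (<-irrefl refl (≤-trans 1≤i (≤-reflexive e)))
    ... | no j′≢i = ⊥-elim (j′≢i (sym e))
    magnitude-injective (suc j) zero e with suc j ≟ i
    ... | yes _  = ⊥-elim (<-irrefl refl (≤-trans 1≤i (≤-reflexive (sym e))))
    ... | no j≢i = ⊥-elim (j≢i e)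
    magnitude-injective (suc j) (suc j′) e with suc j ≟ i | suc j′ ≟ i
    ... | yes j≡i | yes j′≡i = trans j≡i (sym j′≡i)
    ... | no _    | no _     = e
    ... | yes _   | no _     = ⊥-elim (1+n≢0 (sym e))
    ... | no _    | yes _    = ⊥-elim (1+n≢0 e)

    σ-step : ℕ → ℕ → Sign
    σ-step zero zero = σ₁ Sign.* σ₀
    σ-step j    a    = σ (vertex j (back a)) (vertex j (fore a))

    -- Orientation signs of path j at back a and fore a, propagated from back 0.
    τ-back : ℕ → ℕ → Sign
    τ-fore : ℕ → ℕ → Sign
    τ-back j zero    = Sign.+
    τ-back j (suc a) = σ (vertex j (fore a)) (vertex j (back (suc a))) Sign.* τ-fore j a
    τ-fore j a       = σ-step j a Sign.* τ-back j a

    τ : ℕ → Slot → Sign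
    τ j (back a) = τ-back j a
    τ j (fore a) = τ-fore j a

    incidenceSign : ℕ → Slot → Slot → Sign
    incidenceSign j r r′ = if precedes r r′ then τ j r else opposite (τ j r)

    pathColour : ℕ → Fin N → Fin N → ℤ
    pathColour j x y = colour (incidenceSign j (slot j (toℕ x)) (slot j (toℕ y))) (magnitude j)

    f : Fin N → Fin N → ℤ
    f x y = pathColour (pathIndex (toℕ x) (toℕ y)) x y

    -- For x ∈ {0, 1}: the colours at x and at the hub of the edge joining them.
    f-hub : Fin N → ℤ
    f-hub zero    = colour Sign.+ i
    f-hub (suc _) = colour (opposite (τ-fore 0 0)) i

    hub-f : Fin N → ℤ
    hub-f zero    = colour (opposite σ₀) i
    hub-f (suc _) = colour σ₀ i

    τ-Step : ∀ j {r r′} {x y : Fin N} → T (gadgetAdj x y) → vertex j r ≡ x → vertex j r′ ≡ y → Step r r′ →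
             τ j r′ ≡ σ x y Sign.* τ j r
    τ-Step zero    adj refl refl (back→fore zero)    =
      ⊥-elim (¬gadgetAdj-01 (subst₂ (λ x y → T (gadgetAdj x y)) vertex-back0 vertex-fore0 adj))
    τ-Step zero    adj refl refl (back→fore (suc a)) = refl
    τ-Step (suc j) adj refl refl (back→fore a)       = refl
    τ-Step j       adj refl refl (fore→back a)       = refl

    colour-Step : ∀ j m σ′ {r r′} → Step r r′ → τ j r′ ≡ σ′ Sign.* τ j r →
                  colour (incidenceSign j r r′) m ≡ - (signℤ σ′ * colour (incidenceSign j r′ r) m)
    colour-Step j m σ′ {r} st τ≡ rewrite Step⇒precedes st | Step⇒¬precedes st | τ≡ = colour-across σ′ (τ j r) m

    pathColour-across : ∀ {x y} j → j ≤ k → T (gadgetAdj x y) → Consecutive (slot j (toℕ x)) (slot j (toℕ y)) →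
                        pathColour j x y ≡ - (signℤ (σ x y) * pathColour j y x)
    pathColour-across {x} {y} j j≤k adj (inj₁ st) =
      colour-Step j (magnitude j) (σ x y) st (τ-Step j adj (vertex-slot x j≤k) (vertex-slot y j≤k) st)
    pathColour-across {x} {y} j j≤k adj (inj₂ st) = subst (λ σ′ → pathColour j x y ≡ - (signℤ σ′ * pathColour j y x)) (σ-sym y x)
      (across-sym (σ y x) _ _ (colour-Step j (magnitude j) (σ y x) st
        (τ-Step j (subst T (gadgetAdj-sym x y) adj) (vertex-slot y j≤k) (vertex-slot x j≤k) st)))

    f-across : ∀ {x y} → T (gadgetAdj x y) → f x y ≡ - (signℤ (σ x y) * f y x)
    f-across {x} {y} adj =
      trans (pathColour-across (pathIndex (toℕ x) (toℕ y)) (pathIndex≤k (toℕ x) (toℕ y)) adj (consecutive {x} {y} adj))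
            (cong (λ j → - (signℤ (σ x y) * pathColour j y x)) (pathIndex-sym (toℕ x) (toℕ y)))

    incidenceSign-precedes : ∀ j r r₁ r₂ → incidenceSign j r r₁ ≡ incidenceSign j r r₂ → precedes r r₁ ≡ precedes r r₂
    incidenceSign-precedes j r r₁ r₂ e with precedes r r₁ | precedes r r₂
    ... | true  | true  = refl
    ... | false | false = refl
    ... | true  | false = ⊥-elim (s≢opposite[s] (τ j r) e)
    ... | false | true  = ⊥-elim (s≢opposite[s] (τ j r) (sym e))

    f-distinct : ∀ {x y y′} → T (gadgetAdj x y) → T (gadgetAdj x y′) → y ≢ y′ → f x y ≢ f x y′
    f-distinct {x} {y} {y′} adj adj′ y≢y′ e = y≢y′ (toℕ-injective (slot-injective j≤k (toℕ<n y) (toℕ<n y′) same-slot))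
      where
      j  = pathIndex (toℕ x) (toℕ y)
      j′ = pathIndex (toℕ x) (toℕ y′)
      j≤k = pathIndex≤k (toℕ x) (toℕ y)
      j≡j′ : j ≡ j′
      sxy  = incidenceSign j (slot j (toℕ x)) (slot j (toℕ y))
      sxy′ = incidenceSign j′ (slot j′ (toℕ x)) (slot j′ (toℕ y′))
      j≡j′ = magnitude-injective j j′ (colour-injectiveʳ {sxy} {sxy′} {magnitude j} {magnitude j′} e)
      same-sign : incidenceSign j (slot j (toℕ x)) (slot j (toℕ y)) ≡ incidenceSign j (slot j (toℕ x)) (slot j (toℕ y′))
      same-sign = trans (colour-injectiveˡ {sxy} {sxy′} {magnitude j} {magnitude j′} e)
                        (cong (λ j → incidenceSign j (slot j (toℕ x)) (slot j (toℕ y′))) (sym j≡j′))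
      same-slot : slot j (toℕ y) ≡ slot j (toℕ y′)
      same-slot = consecutive-unique (consecutive {x} {y} adj)
        (subst (λ j → Consecutive (slot j (toℕ x)) (slot j (toℕ y′))) (sym j≡j′) (consecutive {x} {y′} adj′))
        (incidenceSign-precedes j (slot j (toℕ x)) (slot j (toℕ y)) (slot j (toℕ y′)) same-sign)

    f-magnitude : ∀ x y → ∃₂ λ s m → m ≤ k × f x y ≡ colour s m
    f-magnitude x y = _ , magnitude j , magnitude≤k j (pathIndex≤k (toℕ x) (toℕ y)) , refl
      where j = pathIndex (toℕ x) (toℕ y)

    f-hub-across₀ : f-hub zero ≡ - (signℤ σ₀ * hub-f zero)
    f-hub-across₀ = subst (λ s → colour Sign.+ i ≡ - (signℤ σ₀ * colour (opposite s) i)) (Sign-*-identityʳ σ₀)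
                      (colour-across σ₀ Sign.+ i)

    f-hub-across₁ : ∀ z → f-hub (suc z) ≡ - (signℤ σ₁ * hub-f (suc z))
    f-hub-across₁ z = subst (λ s → colour (opposite s) i ≡ - (signℤ σ₁ * colour σ₀ i)) (sym (Sign-*-identityʳ (σ₁ Sign.* σ₀)))
                        (across-sym σ₁ _ _ (colour-across σ₁ σ₀ i))

    hub-f-distinct : ∀ z → hub-f zero ≢ hub-f (suc z)
    hub-f-distinct z e = s≢opposite[s] σ₀ (sym (colour-injectiveˡ e))

    -- Only path 0 carries magnitude i; on it 0 and 1 are joined through the hub, not to each other.
    onHubPath : ∀ {x y s} → T (gadgetAdj x y) → f x y ≡ colour s i →
                Consecutive (slot 0 (toℕ x)) (slot 0 (toℕ y)) × incidenceSign 0 (slot 0 (toℕ x)) (slot 0 (toℕ y)) ≡ s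
    onHubPath {x} {y} {s} adj e = subst onPath j≡0 (consecutive {x} {y} adj , colour-injectiveˡ {sxy} {s} {magnitude j} {i} e)
      where
      j = pathIndex (toℕ x) (toℕ y)
      sxy = incidenceSign j (slot j (toℕ x)) (slot j (toℕ y))
      onPath : ℕ → Set
      onPath j = Consecutive (slot j (toℕ x)) (slot j (toℕ y)) × incidenceSign j (slot j (toℕ x)) (slot j (toℕ y)) ≡ s
      j≡0 : j ≡ 0
      j≡0 = magnitude-injective j 0 (colour-injectiveʳ {sxy} {s} {magnitude j} {i} e)

    vertex-of-slot₀ : ∀ {y r} → slot 0 (toℕ y) ≡ r → vertex 0 r ≡ y
    vertex-of-slot₀ {y} e = trans (cong (vertex 0) (sym e)) (vertex-slot y z≤n)

    f≢f-hub₀ : ∀ {y} → T (gadgetAdj zero y) → f zero y ≢ f-hub zero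
    f≢f-hub₀ {y} adj e = ¬gadgetAdj-01 (subst (λ y → T (gadgetAdj zero y)) y≡1 adj)
      where
      next : ∀ {r} → Consecutive (back 0) r → r ≡ fore 0
      next (inj₁ (back→fore 0)) = refl
      next (inj₂ ())
      y≡1 : y ≡ suc zero
      y≡1 = trans (sym (vertex-of-slot₀ {y} (next (proj₁ (onHubPath {zero} {y} {Sign.+} adj e))))) vertex-fore0

    f≢f-hub₁ : ∀ {y} → T (gadgetAdj (suc zero) y) → f (suc zero) y ≢ f-hub (suc zero)
    f≢f-hub₁ {y} adj e = ¬gadgetAdj-10 (subst (λ y → T (gadgetAdj (suc zero) y)) y≡0 adj)
      where
      previous : ∀ {r} → Consecutive (fore 0) r → incidenceSign 0 (fore 0) r ≡ opposite (τ-fore 0 0) → r ≡ back 0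
      previous (inj₁ (fore→back 0)) sign = ⊥-elim (s≢opposite[s] _ sign)
      previous (inj₂ (back→fore 0)) _    = refl
      onPath = onHubPath {suc zero} {y} {opposite (τ-fore 0 0)} adj e
      y≡0 : y ≡ zero
      y≡0 = trans (sym (vertex-of-slot₀ {y} (previous (proj₁ onPath) (proj₂ onPath)))) vertex-back0

  terminal : Fin N → Bool
  terminal zero          = true
  terminal (suc zero)    = true
  terminal (suc (suc _)) = false

  count-terminal : count terminal ≡ 2
  count-terminal = cong (λ n → suc (suc n)) (∑-zero (k + k) (λ _ → refl))

  count-isHubPair : ∀ x → count (isHubPair x) ≡ 𝟙 (terminal x)
  count-isHubPair zero          = cong suc (∑-zero (k + k) (λ _ → refl))
  count-isHubPair (suc zero)    = cong suc (∑-zero (k + k) (λ _ → refl))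
  count-isHubPair (suc (suc x)) = ∑-zero N none
    where
    none : ∀ y → 𝟙 (isHubPair (suc (suc x)) y) ≡ 0
    none zero          = refl
    none (suc zero)    = refl
    none (suc (suc y)) = refl

  exactly-one : ∀ x y → 𝟙 (y == x) + 𝟙 (isHubPair x y) + 𝟙 (gadgetAdj x y) ≡ 1
  exactly-one x y with x == y in x==y | isHubPair x y in hubPair
  ... | true  | true  = ⊥-elim (isHubPair⇒≢ x y (subst T (sym hubPair) _) (==-sound (subst T (sym x==y) _)))
    where
    isHubPair⇒≢ : ∀ x y → T (isHubPair x y) → x ≢ y
    isHubPair⇒≢ zero       (suc zero) _ ()
    isHubPair⇒≢ (suc zero) zero       _ ()
  ... | true  | false rewrite ==-sym y x | x==y = refl
  ... | false | true  rewrite ==-sym y x | x==y = refl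
  ... | false | false rewrite ==-sym y x | x==y = refl

  gadget-degree : ∀ x → 𝟙 (terminal x) + count (gadgetAdj x) ≡ suc (k + k)
  gadget-degree x = suc-injective (begin
      suc (𝟙 (terminal x) + C)             ≡⟨ cong (λ t → suc (t + C)) (sym (count-isHubPair x)) ⟩
      suc (B + C)                          ≡⟨ cong (_+ (B + C)) (sym (count-== N x)) ⟩
      A + (B + C)                          ≡⟨ sym (+-assoc A B C) ⟩
      A + B + C                            ≡⟨ cong (_+ C) (sym (∑-distrib-+ a b)) ⟩
      sum (λ y → a y + b y) + C            ≡⟨ sym (∑-distrib-+ (λ y → a y + b y) c) ⟩
      ∑[ y < N ] (a y + b y + c y)         ≡⟨ sum-cong-≗ (exactly-one x) ⟩
      ∑[ y < N ] 1                         ≡⟨ trans (∑-const N 1) (*-identityʳ N) ⟩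
      N                                    ∎)
    where
    open ≡-Reasoning
    a = λ y → 𝟙 (y == x)
    b = λ y → 𝟙 (isHubPair x y)
    c = λ y → 𝟙 (gadgetAdj x y)
    A = sum a
    B = sum b
    C = sum c

module Construction (k : ℕ) where

  open import Data.Nat using (zero; suc; _+_; _*_; _≤_; s≤s)
  open import Data.Nat.Properties using (≤-trans; ≤-reflexive; m≤m+n; +-identityʳ; *-comm)
  open import Data.Fin using (Fin; zero; suc; _↑ˡ_; _↑ʳ_; splitAt; join; combine; remQuot)
  open import Data.Fin.Properties
    using (splitAt-↑ˡ; splitAt-↑ʳ; join-splitAt; remQuot-combine; combine-remQuot; ↑ˡ-injective; ↑ʳ-injective)
    renaming (suc-injective to Fin-suc-injective)
  open import Data.Bool using (Bool; true; false; T; _∧_; if_then_else_)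
  open import Data.Bool.Properties using (T-∧)
  open import Data.Product using (_×_; _,_; proj₁; proj₂)
  open import Data.Sum using (inj₁; inj₂; [_,_]′)
  open import Function using (_∘_; Equivalence)
  open import Relation.Binary.PropositionalEquality
  open import Defs using (Graph; deg; Δ)
  open Counting
  open Gadget k public

  data Vertex : Set where
    apex   : Vertex
    hub    : Bool → Vertex
    gadget : Bool → Fin k → Fin N → Vertex

  sideSize : ℕ
  sideSize = suc (k * N)

  order : ℕ
  order = suc (sideSize + sideSize)

  onSide : Bool → Fin sideSize → Vertex
  onSide b zero    = hub b
  onSide b (suc y) = gadget b (proj₁ (remQuot {k} N y)) (proj₂ (remQuot {k} N y))

  inSide : Bool → Fin sideSize → Fin order
  inSide true  x = suc (x ↑ˡ sideSize)
  inSide false x = suc (sideSize ↑ʳ x)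

  decode : Fin order → Vertex
  decode zero    = apex
  decode (suc i) = [ onSide true , onSide false ]′ (splitAt sideSize i)

  encode : Vertex → Fin order
  encode apex           = zero
  encode (hub b)        = inSide b zero
  encode (gadget b ι x) = inSide b (suc (combine ι x))

  decode-inSide : ∀ b x → decode (inSide b x) ≡ onSide b x
  decode-inSide true  x rewrite splitAt-↑ˡ sideSize x sideSize = refl
  decode-inSide false x rewrite splitAt-↑ʳ sideSize sideSize x = refl

  encode-onSide : ∀ b x → encode (onSide b x) ≡ inSide b x
  encode-onSide b zero    = refl
  encode-onSide b (suc y) = cong (λ z → inSide b (suc z)) (combine-remQuot {k} N y)

  encode-decode : ∀ u → encode (decode u) ≡ u
  encode-decode zero    = refl
  encode-decode (suc i) with splitAt sideSize i in eq
  ... | inj₁ x = trans (encode-onSide true x)  (cong suc (trans (cong (join sideSize sideSize) (sym eq)) (join-splitAt sideSize sideSize i)))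
  ... | inj₂ x = trans (encode-onSide false x) (cong suc (trans (cong (join sideSize sideSize) (sym eq)) (join-splitAt sideSize sideSize i)))

  decode-injective : ∀ {u v} → decode u ≡ decode v → u ≡ v
  decode-injective {u} {v} e = trans (sym (encode-decode u)) (trans (cong encode e) (encode-decode v))

  inSide-injective : ∀ b {x y} → inSide b x ≡ inSide b y → x ≡ y
  inSide-injective true  e = ↑ˡ-injective sideSize _ _ (Fin-suc-injective e)
  inSide-injective false e = ↑ʳ-injective sideSize _ _ (Fin-suc-injective e)

  data Position : Fin order → Set where
    at-apex : Position zero
    at-side : ∀ b x → Position (inSide b x)

  position : ∀ u → Position u
  position zero    = at-apex
  position (suc i) with splitAt sideSize i in eq
  ... | inj₁ x = subst Position (cong suc (trans (cong (join sideSize sideSize) (sym eq)) (join-splitAt sideSize sideSize i))) (at-side true x)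
  ... | inj₂ x = subst Position (cong suc (trans (cong (join sideSize sideSize) (sym eq)) (join-splitAt sideSize sideSize i))) (at-side false x)

  sameSide : Bool → Bool → Bool
  sameSide true  true  = true
  sameSide false false = true
  sameSide _     _     = false

  sameSide-sym : ∀ b b′ → sameSide b b′ ≡ sameSide b′ b
  sameSide-sym true  true  = refl
  sameSide-sym true  false = refl
  sameSide-sym false true  = refl
  sameSide-sym false false = refl

  sameSide-sound : ∀ {b b′} → T (sameSide b b′) → b ≡ b′
  sameSide-sound {true}  {true}  _ = refl
  sameSide-sound {false} {false} _ = refl

  sameSide∧⇒≡ : ∀ {b b′} p → T (sameSide b b′ ∧ p) → b ≡ b′ × T p
  sameSide∧⇒≡ p adj with Equivalence.to T-∧ adj
  ... | same , Tp = sameSide-sound same , Tp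

  adjacent : Vertex → Vertex → Bool
  adjacent apex           (hub _)          = true
  adjacent (hub _)        apex             = true
  adjacent (hub b)        (gadget b′ ι x)  = sameSide b b′ ∧ terminal x
  adjacent (gadget b ι x) (hub b′)         = sameSide b b′ ∧ terminal x
  adjacent (gadget b ι x) (gadget b′ ι′ y) = sameSide b b′ ∧ (ι == ι′ ∧ gadgetAdj x y)
  adjacent _              _                = false

  adjacent-sym : ∀ a a′ → adjacent a a′ ≡ adjacent a′ a
  adjacent-sym apex           apex             = refl
  adjacent-sym apex           (hub _)          = refl
  adjacent-sym apex           (gadget _ _ _)   = refl
  adjacent-sym (hub _)        apex             = refl
  adjacent-sym (hub _)        (hub _)          = refl
  adjacent-sym (hub b)        (gadget b′ ι x)  = cong (_∧ terminal x) (sameSide-sym b b′)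
  adjacent-sym (gadget _ _ _) apex             = refl
  adjacent-sym (gadget b ι x) (hub b′)         = cong (_∧ terminal x) (sameSide-sym b b′)
  adjacent-sym (gadget b ι x) (gadget b′ ι′ y) =
    cong₂ _∧_ (sameSide-sym b b′) (cong₂ _∧_ (==-sym ι ι′) (gadgetAdj-sym x y))

  adjacent-irrefl : ∀ a → adjacent a a ≡ false
  adjacent-irrefl apex             = refl
  adjacent-irrefl (hub _)          = refl
  adjacent-irrefl (gadget true ι x)  rewrite ==-refl ι | gadgetAdj-irrefl x = refl
  adjacent-irrefl (gadget false ι x) rewrite ==-refl ι | gadgetAdj-irrefl x = refl

  G : Graph
  G = record
    { n         = order
    ; adj       = λ u v → adjacent (decode u) (decode v)
    ; adj-sym   = λ u v → adjacent-sym (decode u) (decode v)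
    ; adj-irref = λ u → adjacent-irrefl (decode u)
    }

  ∑-side : (Vertex → ℕ) → Bool → ℕ
  ∑-side h b = h (hub b) + ∑[ ι < k ] ∑[ x < N ] h (gadget b ι x)

  ∑-onSide : ∀ (h : Vertex → ℕ) b → ∑[ x < sideSize ] h (onSide b x) ≡ ∑-side h b
  ∑-onSide h b = cong (h (hub b) +_) (trans (∑-combine k N (λ y → h (onSide b (suc y))))
    (sum-cong-≗ (λ ι → sum-cong-≗ (λ x → cong (λ p → h (gadget b (proj₁ p) (proj₂ p))) (remQuot-combine {k} {N} ι x)))))

  ∑-decode : ∀ (h : Vertex → ℕ) → ∑[ u < order ] h (decode u) ≡ h apex + (∑-side h true + ∑-side h false)
  ∑-decode h = cong (h apex +_) (trans (∑-↑ sideSize sideSize (λ i → h (decode (suc i))))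
    (cong₂ _+_ (trans (sum-cong-≗ (λ x → cong h (decode-inSide true x)))  (∑-onSide h true))
               (trans (sum-cong-≗ (λ x → cong h (decode-inSide false x))) (∑-onSide h false))))

  degree : Vertex → ℕ
  degree a = 𝟙 (adjacent a apex) + (∑-side (𝟙 ∘ adjacent a) true + ∑-side (𝟙 ∘ adjacent a) false)

  deg≡count : ∀ u → deg G u ≡ count (λ v → adjacent (decode u) (decode v))
  deg≡count u = trans (listSum-allFin order (λ v → if adjacent (decode u) (decode v) then 1 else 0))
    (sum-cong-≗ {order} (λ v → sym (𝟙-if (adjacent (decode u) (decode v)))))

  deg≡degree : ∀ u → deg G u ≡ degree (decode u)
  deg≡degree u = trans (deg≡count u) (∑-decode (𝟙 ∘ adjacent (decode u)))

  two-per-gadget : ∑[ ι < k ] count terminal ≡ k + k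
  two-per-gadget = trans (sum-cong-≗ {k} (λ _ → count-terminal)) (trans (∑-const k 2) (trans (*-comm k 2) (cong (k +_) (+-identityʳ k))))

  ∑-none : ∀ (h : Fin k → Fin N → ℕ) → (∀ ι x → h ι x ≡ 0) → ∑[ ι < k ] ∑[ x < N ] h ι x ≡ 0
  ∑-none h none = ∑-zero k (λ ι → ∑-zero N (none ι))

  degree-apex : degree apex ≡ 2
  degree-apex = cong₂ (λ a b → suc (a + suc b)) (∑-none _ (λ _ _ → refl)) (∑-none _ (λ _ _ → refl))

  degree-hub : ∀ b → degree (hub b) ≡ suc (k + k)
  degree-hub true  = cong suc (trans (cong₂ _+_ two-per-gadget (∑-none _ (λ _ _ → refl))) (+-identityʳ (k + k)))
  degree-hub false = cong suc (cong₂ _+_ (∑-none _ (λ _ _ → refl)) two-per-gadget)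


  ∑-same-copy : ∀ (ι : Fin k) x → ∑[ ι′ < k ] ∑[ y < N ] 𝟙 (ι == ι′ ∧ gadgetAdj x y) ≡ count (gadgetAdj x)
  ∑-same-copy ι x = trans (sum-cong-≗ {k} only-ι) (∑-select k ι (λ _ → count (gadgetAdj x)))
    where
    only-ι : ∀ ι′ → ∑[ y < N ] 𝟙 (ι == ι′ ∧ gadgetAdj x y) ≡ (if ι′ == ι then count (gadgetAdj x) else 0)
    only-ι ι′ rewrite ==-sym ι ι′ with ι′ == ι
    ... | true  = refl
    ... | false = ∑-zero N (λ _ → refl)

  degree-gadget : ∀ b ι x → degree (gadget b ι x) ≡ suc (k + k)
  degree-gadget true  ι x = trans (cong₂ _+_ (cong (𝟙 (terminal x) +_) (∑-same-copy ι x)) (∑-none _ (λ _ _ → refl)))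
                                  (trans (+-identityʳ _) (gadget-degree x))
  degree-gadget false ι x = trans (cong₂ _+_ (∑-none _ (λ _ _ → refl)) (cong (𝟙 (terminal x) +_) (∑-same-copy ι x)))
                                  (gadget-degree x)

  degree-onSide : ∀ b x → degree (onSide b x) ≡ suc (k + k)
  degree-onSide b zero    = degree-hub b
  degree-onSide b (suc y) = degree-gadget b (proj₁ (remQuot {k} N y)) (proj₂ (remQuot {k} N y))

  deg-inSide : ∀ b x → deg G (inSide b x) ≡ suc (k + k)
  deg-inSide b x = trans (deg≡degree (inSide b x)) (trans (cong degree (decode-inSide b x)) (degree-onSide b x))

  degree≤ : 1 ≤ k → ∀ a → degree a ≤ suc (k + k)
  degree≤ 1≤k apex           = ≤-trans (≤-reflexive degree-apex) (s≤s (≤-trans 1≤k (m≤m+n k k)))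
  degree≤ _   (hub b)        = ≤-reflexive (degree-hub b)
  degree≤ _   (gadget b ι x) = ≤-reflexive (degree-gadget b ι x)

  Δ-G : 1 ≤ k → Δ G ≡ suc (k + k)
  Δ-G 1≤k = max-allFin-attained order (deg G) (λ u → subst (_≤ suc (k + k)) (sym (deg≡degree u)) (degree≤ 1≤k (decode u)))
                                         (inSide true zero) (deg-inSide true zero)

module UpperBound (k : ℕ) where

  open import Data.Nat as ℕ using (zero; suc; _+_; _≤_; z≤n; s≤s)
  open import Data.Nat.Properties using (suc-injective; 0≢1+n)
  open import Data.Fin using (Fin; zero; suc; toℕ)
  open import Data.Fin.Properties using (toℕ<n; toℕ-injective) renaming (_≟_ to _≟ᶠ_)
  open import Data.Bool using (Bool; true; false; T; _∧_)
  open import Data.Bool.Properties using (T-∧)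
  open import Data.Integer using (ℤ; +_; -_; _*_)
  open import Data.Sign as Sign using (Sign; opposite)
  open import Data.Sign.Properties using (s≢opposite[s]) renaming (*-identityʳ to Sign-*-identityʳ)
  open import Data.Product using (∃; ∃₂; _×_; _,_; proj₁; proj₂)
  open import Data.Sum using (inj₂)
  open import Function using (Equivalence)
  open import Relation.Binary.PropositionalEquality
  open import Relation.Nullary using (yes; no)
  open import Data.Nat.Tactic.RingSolver using (solve-∀)
  open Counting using (_==_; ==-sound)
  open SignedColour
  open Construction k

  colour∈M : ∀ t m → m ≤ k → M (suc (suc (2 ℕ.* k))) (colour t m)
  colour∈M t m m≤k =
    inj₂ (suc k , shift k , subst (1 ≤_) (sym (∣colour∣ t m)) (s≤s z≤n) , subst (_≤ suc k) (sym (∣colour∣ t m)) (s≤s m≤k))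
    where
    shift : ∀ k → suc (suc (2 ℕ.* k)) ≡ 2 ℕ.* suc k
    shift = solve-∀

  gadget-adjacent : ∀ {b b′ ι ι′ x y} → T (adjacent (gadget b ι x) (gadget b′ ι′ y)) →
                    b ≡ b′ × ι ≡ ι′ × T (gadgetAdj x y)
  gadget-adjacent {b} {b′} {ι} {ι′} {x} {y} adj with sameSide∧⇒≡ {b} {b′} (ι == ι′ ∧ gadgetAdj x y) adj
  ... | b≡b′ , rest with Equivalence.to T-∧ rest
  ... | ι==ι′ , gadgetAdj-xy = b≡b′ , ==-sound ι==ι′ , gadgetAdj-xy

  module _ (s : Signature G) where

    σᵥ : Vertex → Vertex → Sign
    σᵥ a b = σ s (encode a) (encode b)

    σᵥ-sym : ∀ a b → σᵥ a b ≡ σᵥ b a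
    σᵥ-sym a b = σ-sym s (encode a) (encode b)

    module Copy (b : Bool) (ι : Fin k) = Colouring (suc (toℕ ι)) (s≤s z≤n) (toℕ<n ι)
      (λ x y → σᵥ (gadget b ι x) (gadget b ι y)) (λ x y → σᵥ-sym (gadget b ι x) (gadget b ι y))
      (σᵥ (gadget b ι zero) (hub b)) (σᵥ (hub b) (gadget b ι (suc zero)))

    σ-apex : Sign
    σ-apex = σᵥ (hub true) apex

    -- The two apex edges form the path hub true, apex, hub false, coloured with magnitude 0.
    F : Vertex → Vertex → ℤ
    F (hub b)        (gadget _ ι x) = Copy.hub-f b ι x
    F (gadget b ι x) (hub _)        = Copy.f-hub b ι x
    F (gadget b ι x) (gadget _ _ y) = Copy.f b ι x y
    F (hub true)     apex           = colour Sign.+ 0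
    F (hub false)    apex           = colour (opposite (σᵥ apex (hub false) Sign.* σ-apex)) 0
    F apex           (hub true)     = colour (opposite σ-apex) 0
    F apex           (hub false)    = colour σ-apex 0
    F _              _              = + 0

    hub-f-colour : ∀ b ι x → ∃ λ t → Copy.hub-f b ι x ≡ colour t (suc (toℕ ι))
    hub-f-colour b ι zero    = opposite (σᵥ (gadget b ι zero) (hub b)) , refl
    hub-f-colour b ι (suc x) = σᵥ (gadget b ι zero) (hub b) , refl

    F-colour : ∀ a a′ → T (adjacent a a′) → ∃₂ λ t m → m ≤ k × F a a′ ≡ colour t m
    F-colour apex           (hub true)     _ = _ , 0 , z≤n , refl
    F-colour apex           (hub false)    _ = _ , 0 , z≤n , refl
    F-colour (hub true)     apex           _ = Sign.+ , 0 , z≤n , refl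
    F-colour (hub false)    apex           _ = _ , 0 , z≤n , refl
    F-colour (hub b)        (gadget _ ι x) _ = proj₁ (hub-f-colour b ι x) , _ , toℕ<n ι , proj₂ (hub-f-colour b ι x)
    F-colour (gadget b ι zero)    (hub _)  _ = Sign.+ , _ , toℕ<n ι , refl
    F-colour (gadget b ι (suc x)) (hub _)  _ = opposite (Copy.τ-fore b ι 0 0) , _ , toℕ<n ι , refl
    F-colour (gadget b ι x) (gadget _ _ y) _ = Copy.f-magnitude b ι x y

    across-flip : ∀ a a′ → F a a′ ≡ - (signℤ (σᵥ a a′) * F a′ a) → F a′ a ≡ - (signℤ (σᵥ a′ a) * F a a′)
    across-flip a a′ e =
      subst (λ σ′ → F a′ a ≡ - (signℤ σ′ * F a a′)) (σᵥ-sym a a′) (across-sym (σᵥ a a′) (F a a′) (F a′ a) e)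

    apex-across-true : F apex (hub true) ≡ - (signℤ (σᵥ apex (hub true)) * F (hub true) apex)
    apex-across-true = subst (λ σ′ → colour (opposite σ-apex) 0 ≡ - (signℤ σ′ * colour Sign.+ 0)) (σᵥ-sym (hub true) apex)
      (across-sym σ-apex _ _ (subst (λ t → colour Sign.+ 0 ≡ - (signℤ σ-apex * colour (opposite t) 0)) (Sign-*-identityʳ σ-apex)
        (colour-across σ-apex Sign.+ 0)))

    apex-across-false : F apex (hub false) ≡ - (signℤ (σᵥ apex (hub false)) * F (hub false) apex)
    apex-across-false = colour-across (σᵥ apex (hub false)) σ-apex 0

    gadget-hub-across : ∀ b ι x → T (terminal x) →
                        F (gadget b ι x) (hub b) ≡ - (signℤ (σᵥ (gadget b ι x) (hub b)) * F (hub b) (gadget b ι x))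
    gadget-hub-across b ι zero       _ = Copy.f-hub-across₀ b ι
    gadget-hub-across b ι (suc zero) _ =
      subst (λ σ′ → Copy.f-hub b ι (suc zero) ≡ - (signℤ σ′ * Copy.hub-f b ι (suc zero))) (σᵥ-sym (hub b) (gadget b ι (suc zero)))
        (Copy.f-hub-across₁ b ι zero)

    F-across : ∀ a a′ → T (adjacent a a′) → F a a′ ≡ - (signℤ (σᵥ a a′) * F a′ a)
    F-across apex           (hub true)      _   = apex-across-true
    F-across apex           (hub false)     _   = apex-across-false
    F-across (hub true)     apex            _   = across-flip apex (hub true) apex-across-true
    F-across (hub false)    apex            _   = across-flip apex (hub false) apex-across-false
    F-across (gadget b ι x) (hub b′)        adj with sameSide∧⇒≡ {b} {b′} (terminal x) adj
    ... | refl , terminal-x = gadget-hub-across b ι x terminal-x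
    F-across (hub b)        (gadget b′ ι x) adj with sameSide∧⇒≡ {b} {b′} (terminal x) adj
    ... | refl , terminal-x = across-flip (gadget b ι x) (hub b) (gadget-hub-across b ι x terminal-x)
    F-across (gadget b ι x) (gadget b′ ι′ y) adj with gadget-adjacent {b} {b′} {ι} {ι′} {x} {y} adj
    ... | refl , refl , adj-xy = Copy.f-across b ι {x} {y} adj-xy

    hub-f-distinct : ∀ b ι {x x′} → T (terminal x) → T (terminal x′) → x ≢ x′ → Copy.hub-f b ι x ≢ Copy.hub-f b ι x′
    hub-f-distinct b ι {zero}        {zero}        _ _  x≢x′ _ = x≢x′ refl
    hub-f-distinct b ι {zero}        {suc zero}    _ _  _    e = Copy.hub-f-distinct b ι zero e
    hub-f-distinct b ι {suc zero}    {zero}        _ _  _    e = Copy.hub-f-distinct b ι zero (sym e)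
    hub-f-distinct b ι {suc zero}    {suc zero}    _ _  x≢x′ _ = x≢x′ refl
    hub-f-distinct b ι {zero}        {suc (suc _)} _ ()
    hub-f-distinct b ι {suc zero}    {suc (suc _)} _ ()
    hub-f-distinct b ι {suc (suc _)} {_}           ()

    F-hub-apex : ∀ b → ∃ λ t → F (hub b) apex ≡ colour t 0
    F-hub-apex true  = Sign.+ , refl
    F-hub-apex false = opposite (σᵥ apex (hub false) Sign.* σ-apex) , refl

    apex≢gadget-colour : ∀ b b′ ι x → F (hub b) apex ≢ F (hub b) (gadget b′ ι x)
    apex≢gadget-colour b b′ ι x e with F-hub-apex b | hub-f-colour b ι x
    ... | t , apex≡ | t′ , gadget≡ =
      0≢1+n (colour-injectiveʳ {t} {t′} {0} {suc (toℕ ι)} (trans (sym apex≡) (trans e gadget≡)))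

    F-distinct-at-hub : ∀ b a₁ a₂ → T (adjacent (hub b) a₁) → T (adjacent (hub b) a₂) → a₁ ≢ a₂ →
                        F (hub b) a₁ ≢ F (hub b) a₂
    F-distinct-at-hub b apex apex _ _ a₁≢a₂ _ = a₁≢a₂ refl
    F-distinct-at-hub b apex (gadget b₂ ι x) _ _ _ e = apex≢gadget-colour b b₂ ι x e
    F-distinct-at-hub b (gadget b₁ ι x) apex _ _ _ e = apex≢gadget-colour b b₁ ι x (sym e)
    F-distinct-at-hub b (gadget b₁ ι x) (gadget b₂ ι′ x′) adj₁ adj₂ a₁≢a₂ e
      with sameSide∧⇒≡ {b} {b₁} (terminal x) adj₁ | sameSide∧⇒≡ {b} {b₂} (terminal x′) adj₂ | ι ≟ᶠ ι′
    ... | refl , terminal-x | refl , terminal-x′ | yes refl =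
      hub-f-distinct b ι terminal-x terminal-x′ (λ x≡x′ → a₁≢a₂ (cong (gadget b ι) x≡x′)) e
    ... | _ | _ | no ι≢ι′ with hub-f-colour b ι x | hub-f-colour b ι′ x′
    ...   | t , ≡t | t′ , ≡t′ =
      ι≢ι′ (toℕ-injective (suc-injective
        (colour-injectiveʳ {t} {t′} {suc (toℕ ι)} {suc (toℕ ι′)} (trans (sym ≡t) (trans e ≡t′)))))

    F-distinct-at-apex : ∀ a₁ a₂ → T (adjacent apex a₁) → T (adjacent apex a₂) → a₁ ≢ a₂ → F apex a₁ ≢ F apex a₂
    F-distinct-at-apex (hub true)  (hub true)  _ _ a₁≢a₂ _ = a₁≢a₂ refl
    F-distinct-at-apex (hub false) (hub false) _ _ a₁≢a₂ _ = a₁≢a₂ refl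
    F-distinct-at-apex (hub true)  (hub false) _ _ _ e =
      s≢opposite[s] σ-apex (sym (colour-injectiveˡ {opposite σ-apex} {σ-apex} {0} {0} e))
    F-distinct-at-apex (hub false) (hub true)  _ _ _ e =
      s≢opposite[s] σ-apex (colour-injectiveˡ {σ-apex} {opposite σ-apex} {0} {0} e)

    f-hub≢f : ∀ b ι {x y} → T (terminal x) → T (gadgetAdj x y) → Copy.f-hub b ι x ≢ Copy.f b ι x y
    f-hub≢f b ι {zero}     {y} _ adj e = Copy.f≢f-hub₀ b ι {y} adj (sym e)
    f-hub≢f b ι {suc zero} {y} _ adj e = Copy.f≢f-hub₁ b ι {y} adj (sym e)

    F-distinct-at-gadget : ∀ b ι x a₁ a₂ → T (adjacent (gadget b ι x) a₁) → T (adjacent (gadget b ι x) a₂) → a₁ ≢ a₂ →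
                           F (gadget b ι x) a₁ ≢ F (gadget b ι x) a₂
    F-distinct-at-gadget b ι x (hub b₁) (hub b₂) adj₁ adj₂ a₁≢a₂ _
      with sameSide∧⇒≡ {b} {b₁} (terminal x) adj₁ | sameSide∧⇒≡ {b} {b₂} (terminal x) adj₂
    ... | refl , _ | refl , _ = a₁≢a₂ refl
    F-distinct-at-gadget b ι x (hub b₁) (gadget b₂ ι₂ y) adj₁ adj₂ _ e
      with sameSide∧⇒≡ {b} {b₁} (terminal x) adj₁ | gadget-adjacent {b} {b₂} {ι} {ι₂} {x} {y} adj₂
    ... | _ , terminal-x | refl , refl , adj-xy = f-hub≢f b ι terminal-x adj-xy e
    F-distinct-at-gadget b ι x (gadget b₁ ι₁ y) (hub b₂) adj₁ adj₂ _ e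
      with gadget-adjacent {b} {b₁} {ι} {ι₁} {x} {y} adj₁ | sameSide∧⇒≡ {b} {b₂} (terminal x) adj₂
    ... | refl , refl , adj-xy | _ , terminal-x = f-hub≢f b ι terminal-x adj-xy (sym e)
    F-distinct-at-gadget b ι x (gadget b₁ ι₁ y₁) (gadget b₂ ι₂ y₂) adj₁ adj₂ a₁≢a₂ e
      with gadget-adjacent {b} {b₁} {ι} {ι₁} {x} {y₁} adj₁ | gadget-adjacent {b} {b₂} {ι} {ι₂} {x} {y₂} adj₂
    ... | refl , refl , adj-xy₁ | refl , refl , adj-xy₂ =
      Copy.f-distinct b ι {x} {y₁} {y₂} adj-xy₁ adj-xy₂ (λ y₁≡y₂ → a₁≢a₂ (cong (gadget b ι) y₁≡y₂)) e

    F-distinct : ∀ a a₁ a₂ → T (adjacent a a₁) → T (adjacent a a₂) → a₁ ≢ a₂ → F a a₁ ≢ F a a₂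
    F-distinct apex           = F-distinct-at-apex
    F-distinct (hub b)        = F-distinct-at-hub b
    F-distinct (gadget b ι x) = F-distinct-at-gadget b ι x

    σ≡σᵥ : ∀ u v → σ s u v ≡ σᵥ (decode u) (decode v)
    σ≡σᵥ u v = sym (cong₂ (σ s) (encode-decode u) (encode-decode v))

    colouring : IsEdgeColoring G s (suc (suc (2 ℕ.* k))) (λ u v → F (decode u) (decode v))
    colouring =
        (λ u v adj → let (t , m , m≤k , F≡) = F-colour (decode u) (decode v) adj in subst (M _) (sym F≡) (colour∈M t m m≤k))
      , (λ u v adj → subst (λ σ′ → F (decode u) (decode v) ≡ - (signℤ σ′ * F (decode v) (decode u))) (sym (σ≡σᵥ u v))
                       (F-across (decode u) (decode v) adj))
      , (λ u v w adj₁ adj₂ v≢w → F-distinct (decode u) (decode v) (decode w) adj₁ adj₂ (λ e → v≢w (decode-injective e)))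

module LowerBound (k : ℕ) where

  open import Data.Nat using (zero; suc; pred; _+_; _*_; _≤_; _<_; s≤s; ⌊_/2⌋)
  open import Data.Nat.Properties
  open import Data.Fin using (Fin; zero; suc)
  open import Data.Fin.Properties using (any?) renaming (_≟_ to _≟ᶠ_)
  open import Data.Bool using (Bool; true; false; T)
  open import Data.Integer as ℤ using (ℤ; +_; -[1+_]; ∣_∣)
  open import Data.Integer.Properties using () renaming (*-zeroʳ to ℤ-*-zeroʳ; _≟_ to _≟ℤ_)
  open import Data.Product using (∃; _×_; _,_; proj₁; proj₂)
  open import Data.Sum using (_⊎_; inj₁; inj₂)
  open import Function using (_∘_)
  open import Relation.Binary.PropositionalEquality
  open import Relation.Nullary using (¬_; yes; no)
  open import Relation.Nullary.Decidable using (T?; _×-dec_)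
  open import Data.Empty using (⊥; ⊥-elim)
  open import Data.Nat.Tactic.RingSolver using (solve-∀)
  open Counting
  open Parity
  open Construction k

  code : ℤ → ℕ
  code (+ n)    = 2 * n
  code -[1+ n ] = suc (2 * n)

  code-injective : ∀ {c c′} → code c ≡ code c′ → c ≡ c′
  code-injective {+ n}      {+ n′}      e = cong +_ (*-cancelˡ-≡ n n′ 2 e)
  code-injective {+ n}      { -[1+ n′ ]} e = ⊥-elim (even≢odd n n′ e)
  code-injective { -[1+ n ]} {+ n′}      e = ⊥-elim (even≢odd n′ n (sym e))
  code-injective { -[1+ n ]} { -[1+ n′ ]} e = cong -[1+_] (*-cancelˡ-≡ n n′ 2 (suc-injective e))

  code≤ : ∀ c {K} → ∣ c ∣ ≤ K → code c ≤ 2 * K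
  code≤ (+ n)      n≤K   = *-monoʳ-≤ 2 n≤K
  code≤ -[1+ n ]   1+n≤K = ≤-trans (*-monoʳ-< 2 (n<1+n n)) (*-monoʳ-≤ 2 1+n≤K)

  suc-pred-code : ∀ {c} → c ≢ + 0 → suc (pred (code c)) ≡ code c
  suc-pred-code {+ zero}   c≢0 = ⊥-elim (c≢0 refl)
  suc-pred-code {+ suc n}  _   = refl
  suc-pred-code { -[1+ n ]} _  = refl

  odd-palette : ∀ {K c} → M (suc (2 * K)) c → ∣ c ∣ ≤ K
  odd-palette {K} {c} (inj₁ (K′ , e , c≤K′)) = subst (∣ c ∣ ≤_) (sym (*-cancelˡ-≡ K K′ 2 (suc-injective e))) c≤K′
  odd-palette {K}     (inj₂ (K′ , e , _ , _)) = ⊥-elim (even≢odd K′ K (sym e))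

  even-palette : ∀ {K c} → M (2 * K) c → c ≢ + 0 × ∣ c ∣ ≤ K
  even-palette {K}     (inj₁ (K′ , e , _))       = ⊥-elim (even≢odd K K′ e)
  even-palette {K} {c} (inj₂ (K′ , e , 1≤c , c≤K′)) = nonzero 1≤c , subst (∣ c ∣ ≤_) (sym (*-cancelˡ-≡ K K′ 2 e)) c≤K′
    where
    nonzero : ∀ {c} → 1 ≤ ∣ c ∣ → c ≢ + 0
    nonzero 1≤c refl = 1+n≰n 1≤c

  deg-inSide-odd : ∀ b x → deg G (inSide b x) ≡ suc (2 * k)
  deg-inSide-odd b x = trans (deg-inSide b x) (cong (λ t → suc (k + t)) (sym (+-identityʳ k)))

  onSide-adjacent : ∀ {b b′} x x′ → T (adjacent (onSide b x) (onSide b′ x′)) → b ≡ b′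
  onSide-adjacent zero    zero     ()
  onSide-adjacent zero    (suc y′) adj = proj₁ (sameSide∧⇒≡ _ adj)
  onSide-adjacent (suc y) zero     adj = proj₁ (sameSide∧⇒≡ _ adj)
  onSide-adjacent (suc y) (suc y′) adj = proj₁ (sameSide∧⇒≡ _ adj)

  onSide-adjacent-apex : ∀ {b} x → T (adjacent (onSide b x) apex) → x ≡ zero
  onSide-adjacent-apex zero    _  = refl
  onSide-adjacent-apex (suc y) ()

  neighbour-of-inSide : ∀ b x v → T (adjacent (decode (inSide b x)) (decode v)) →
                        (v ≡ zero × x ≡ zero) ⊎ ∃ λ x′ → v ≡ inSide b x′
  neighbour-of-inSide b x v adj with position v
  ... | at-apex      = inj₁ (refl , onSide-adjacent-apex x (subst (λ a → T (adjacent a apex)) (decode-inSide b x) adj))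
  ... | at-side b′ x′ = inj₂ (x′ , cong (λ b → inSide b x′)
          (sym (onSide-adjacent x x′ (subst₂ (λ a a′ → T (adjacent a a′)) (decode-inSide b x) (decode-inSide b′ x′) adj))))

  sideSize-odd : ∀ q → sideSize ≢ q + q
  sideSize-odd q e = even≢odd q (k * suc k) (trans e′ (cong suc (kN k)))
    where
    e′ : 2 * q ≡ sideSize
    e′ = trans (cong (λ t → q + t) (+-identityʳ q)) (sym e)
    kN : ∀ k → k * suc (suc (k + k)) ≡ 2 * (k * suc k)
    kN = solve-∀

  module _ (s : Signature G) (m : ℕ) (f : Fin order → Fin order → ℤ) (proper : IsEdgeColoring G s m f) where

    adjG : Fin order → Fin order → Bool
    adjG u v = adjacent (decode u) (decode v)

    in-palette : ∀ u v → T (adjG u v) → M m (f u v)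
    in-palette = proj₁ proper

    f-injective : ∀ u {v w} → T (adjG u v) → T (adjG u w) → f u v ≡ f u w → v ≡ w
    f-injective u {v} {w} adj-v adj-w e with v ≟ᶠ w
    ... | yes v≡w = v≡w
    ... | no v≢w  = ⊥-elim (proj₂ (proj₂ proper) u v w adj-v adj-w v≢w e)

    deg≤-of-labels : ∀ u r (label : ℤ → ℕ) → (∀ v → T (adjG u v) → label (f u v) < r) →
                     (∀ {v w} → T (adjG u v) → T (adjG u w) → label (f u v) ≡ label (f u w) → f u v ≡ f u w) → deg G u ≤ r
    deg≤-of-labels u r label label<r label-injective =
      subst (_≤ r) (sym (deg≡count u))
        (count≤-injective-label order r (adjG u) (label ∘ f u) label<r
          (λ v w adj-v adj-w e → f-injective u adj-v adj-w (label-injective adj-v adj-w e)))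

    deg≤-bounded : ∀ K u → (∀ v → T (adjG u v) → ∣ f u v ∣ ≤ K) → deg G u ≤ suc (2 * K)
    deg≤-bounded K u bounded =
      deg≤-of-labels u (suc (2 * K)) code (λ v adj → s≤s (code≤ (f u v) (bounded v adj))) (λ _ _ → code-injective)

    -- Without the colour 0, the shifted code pred ∘ code is still injective.
    deg≤-nonzero : ∀ K u → (∀ v → T (adjG u v) → f u v ≢ + 0 × ∣ f u v ∣ ≤ K) → deg G u ≤ 2 * K
    deg≤-nonzero K u nonzero = deg≤-of-labels u (2 * K) (pred ∘ code)
      (λ v adj → subst (_≤ 2 * K) (sym (suc-pred-code (proj₁ (nonzero v adj)))) (code≤ (f u v) (proj₂ (nonzero v adj))))
      (λ {v} {w} adj-v adj-w e → code-injective
        (trans (sym (suc-pred-code (proj₁ (nonzero v adj-v)))) (trans (cong suc e) (suc-pred-code (proj₁ (nonzero w adj-w))))))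

    hub₀ : Fin order
    hub₀ = inSide true zero

    in-palette-of : ∀ {m′} → m ≡ m′ → ∀ u v → T (adjG u v) → M m′ (f u v)
    in-palette-of refl = in-palette

    palette-odd : m ≤ suc (2 * k) → m ≡ suc (2 * k)
    palette-odd m≤ with parity m
    ... | zero , _ , m≡2h =
      ⊥-elim (even≢odd h k (≤-antisym (subst (_≤ suc (2 * k)) m≡2h m≤) (subst (_≤ 2 * h) (deg-inSide-odd true zero) deg≤2h)))
      where
      h = ⌊ m /2⌋
      deg≤2h : deg G hub₀ ≤ 2 * h
      deg≤2h = deg≤-nonzero h hub₀ (λ v adj → even-palette {h} {f hub₀ v} (in-palette-of m≡2h hub₀ v adj))
    ... | suc zero , _ , m≡1+2h =
      trans m≡1+2h (≤-antisym (subst (_≤ suc (2 * k)) m≡1+2h m≤) (subst (_≤ suc (2 * h)) (deg-inSide-odd true zero) deg≤1+2h))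
      where
      h = ⌊ m /2⌋
      deg≤1+2h : deg G hub₀ ≤ suc (2 * h)
      deg≤1+2h = deg≤-bounded h hub₀ (λ v adj → odd-palette {h} {f hub₀ v} (in-palette-of m≡1+2h hub₀ v adj))
    ... | suc (suc _) , s≤s () , _

    -- With 2k+1 colours every vertex of degree 2k+1 sees the colour 0; the 0-coloured edges match
    -- each side (of odd size) except for its hub, so both hubs are matched to the apex.
    module _ (m≡ : m ≡ suc (2 * k)) where

      bounded : ∀ u v → T (adjG u v) → ∣ f u v ∣ ≤ k
      bounded u v adj = odd-palette {k} {f u v} (in-palette-of m≡ u v adj)

      zero-neighbour : ∀ u → deg G u ≡ suc (2 * k) → ∃ λ v → T (adjG u v) × f u v ≡ + 0
      zero-neighbour u full with any? (λ v → T? (adjG u v) ×-dec (f u v ≟ℤ + 0))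
      ... | yes found = found
      ... | no none   = ⊥-elim (1+n≰n (subst (_≤ 2 * k) full
                          (deg≤-nonzero k u (λ v adj → (λ e → none (v , adj , e)) , bounded u v adj))))

      zero-across : ∀ {u v} → T (adjG u v) → f u v ≡ + 0 → f v u ≡ + 0
      zero-across {u} {v} adj e = begin
        f v u                             ≡⟨ proj₁ (proj₂ proper) v u (subst T (adjacent-sym (decode u) (decode v)) adj) ⟩
        ℤ.- (signℤ (σ s v u) ℤ.* f u v)   ≡⟨ cong (λ c → ℤ.- (signℤ (σ s v u) ℤ.* c)) e ⟩
        ℤ.- (signℤ (σ s v u) ℤ.* + 0)     ≡⟨ cong ℤ.-_ (ℤ-*-zeroʳ (signℤ (σ s v u))) ⟩
        + 0                               ∎
        where open ≡-Reasoning

      partner : Bool → Fin sideSize → Fin order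
      partner b x = proj₁ (zero-neighbour (inSide b x) (deg-inSide-odd b x))

      partner-adjacent : ∀ b x → T (adjG (inSide b x) (partner b x))
      partner-adjacent b x = proj₁ (proj₂ (zero-neighbour (inSide b x) (deg-inSide-odd b x)))

      partner-zero : ∀ b x → f (inSide b x) (partner b x) ≡ + 0
      partner-zero b x = proj₂ (proj₂ (zero-neighbour (inSide b x) (deg-inSide-odd b x)))

      partner-back : ∀ b x x′ → partner b x ≡ inSide b x′ → partner b x′ ≡ inSide b x
      partner-back b x x′ e = f-injective (inSide b x′) (partner-adjacent b x′) adj-x′x
        (trans (partner-zero b x′) (sym (zero-across adj-xx′ (trans (cong (f (inSide b x)) (sym e)) (partner-zero b x)))))
        where
        adj-xx′ : T (adjG (inSide b x) (inSide b x′))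
        adj-xx′ = subst (λ v → T (adjG (inSide b x) v)) e (partner-adjacent b x)
        adj-x′x : T (adjG (inSide b x′) (inSide b x))
        adj-x′x = subst T (adjacent-sym (decode (inSide b x)) (decode (inSide b x′))) adj-xx′

      hub-partner-apex : ∀ b → partner b zero ≡ zero
      hub-partner-apex b with partner b zero ≟ᶠ zero
      ... | yes p≡apex = p≡apex
      ... | no p≢apex  = ⊥-elim (sideSize-odd (proj₁ even) (proj₂ even))
        where
        stays : ∀ x → ∃ λ x′ → partner b x ≡ inSide b x′
        stays x with neighbour-of-inSide b x (partner b x) (partner-adjacent b x)
        ... | inj₁ (p≡apex , refl) = ⊥-elim (p≢apex p≡apex)
        ... | inj₂ found            = found
        q : Fin sideSize → Fin sideSize
        q x = proj₁ (stays x)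
        q-involutive : ∀ x → q (q x) ≡ x
        q-involutive x = inSide-injective b (trans (sym (proj₂ (stays (q x)))) (partner-back b x (q x) (proj₂ (stays x))))
        q-fixedPointFree : ∀ x → q x ≢ x
        q-fixedPointFree x qx≡x = subst T (adjacent-irrefl (decode (inSide b x)))
          (subst (λ v → T (adjG (inSide b x) v)) (trans (proj₂ (stays x)) (cong (inSide b) qx≡x)) (partner-adjacent b x))
        even = involution-fixedPointFree⇒even sideSize q q-involutive q-fixedPointFree

      apex-zero : ∀ b → f zero (inSide b zero) ≡ + 0
      apex-zero b = zero-across (subst (λ v → T (adjG (inSide b zero) v)) (hub-partner-apex b) (partner-adjacent b zero))
                                (subst (λ v → f (inSide b zero) v ≡ + 0) (hub-partner-apex b) (partner-zero b zero))

      apex-adjacent : ∀ b → T (adjG zero (inSide b zero))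
      apex-adjacent b = subst (λ a → T (adjacent apex a)) (sym (decode-inSide b zero)) _

      hubs-collide : ⊥
      hubs-collide with cong decode (f-injective zero (apex-adjacent true) (apex-adjacent false) (trans (apex-zero true) (sym (apex-zero false))))
      ... | hub-true≡hub-false rewrite decode-inSide true zero | decode-inSide false zero with hub-true≡hub-false
      ... | ()

  not-colourable : ∀ s m → m ≤ suc (2 * k) → ¬ Colorable G s m
  not-colourable s m m≤ (f , proper) = hubs-collide s m f proper (palette-odd s m f proper m≤)

open import Data.Nat using (ℕ; suc; _+_; _*_; _≤_; _<_; s≤s; z≤n)
open import Data.Nat.Properties using (+-identityʳ; ≤-pred)
open import Data.Product using (Σ; _×_; _,_)
open import Relation.Binary.PropositionalEquality using (_≡_; cong; subst; sym; trans)

theorem3 : (k : ℕ) → 1 ≤ k → Σ Graph (λ G → (Δ G ≡ suc (2 * k)) × Class2± G)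
theorem3 k 1≤k = G , Δ≡ , class2±
  where
  open Construction k using (G; Δ-G)
  Δ≡ : Δ G ≡ suc (2 * k)
  Δ≡ = trans (Δ-G 1≤k) (cong (λ t → suc (k + t)) (sym (+-identityʳ k)))
  class2± : Class2± G
  class2± s = s≤s z≤n
            , subst (Colorable G s) (cong suc (sym Δ≡)) (_ , UpperBound.colouring k s)
            , λ m _ m<χ → LowerBound.not-colourable k s m (≤-pred (subst (m <_) (cong suc Δ≡) m<χ))
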